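{- Let $a,n,k$ be positive integers and $\alpha=(a,a,\dots,a)=a^n$. Then $$\operatorname{Mah}_{\alpha,k}(q)=\frac{[k]_q!}{([a]_q!)^n}\,S^{(a)}_{n,k}(q).$$ In particular, for $a=1$, $\operatorname{Mah}_{1^n,k}(q)=[k]_q!\,S^{(1)}_{n,k}(q)$, where $S^{(1)}_{n,k}(q)$ are the $q$-Stirling numbers of the second kind given by the $a=1$ case of the recursion below.
   Context: $\mathcal{OP}_{\alpha,k}$ is the set of ordered partitions of the multiset $\{i^{\alpha_i}\}$ into $k$ blocks, each a nonempty set. $\operatorname{inv}(\pi)$ is the number of pairs of entries $(x,y)$ with $x>y$, $x$'s block strictly to the left of $y$'s block, and $y$ minimal in its block. The Mahonian distribution is $\operatorname{Mah}_{\alpha,k}(q)=\sum_{\pi\in\mathcal{OP}_{\alpha,k}}q^{\operatorname{inv}(\pi)}$. $[m]_q=(1-q^m)/(1-q)$, $[m]_q!=[m]_q[m-1]_q\cdots[1]_q$, and $\genfrac{[}{]}{0pt}{}{m}{j}_q=\frac{[m]_q!}{[j]_q![m-j]_q!}$ for $0\le j\le m$, and $0$ otherwise. The polynomials $S^{(a)}_{n,k}(q)$ are defined by $S^{(a)}_{1,k}(q)=\chi(k=a)$ and, for $n\ge2$, $$S^{(a)}_{n,k}(q)=\sum_{i=1}^{k}q^{\binom{a-k+i}{2}}\genfrac{[}{]}{0pt}{}{i}{a-k+i}_q\frac{[a]_q!}{[k-i]_q!}\,S^{(a)}_{n-1,i}(q).$$ -}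

module Defs where

open import Data.Bool using (Bool; true; false; if_then_else_; _∧_; not)
open import Data.Nat using (ℕ; zero; suc; _+_; _*_; _∸_; _^_; _<ᵇ_; _≡ᵇ_; _/_; NonZero)
open import Data.Nat.Properties using (m*n≢0)
open import Data.Nat.Combinatorics using (_C_)
open import Data.Fin using (Fin; toℕ)
open import Data.Fin.Subset using (Subset)
open import Data.List using (List; []; _∷_; map; concatMap; allFin; upTo)
open import Data.Nat.ListAction using (sum)
open import Data.Bool.ListAction using (all; any)
open import Data.Vec using (Vec; []; _∷_; lookup)

-- q-analogues, evaluated at a natural number q

qint : ℕ → ℕ → ℕ
qint q zero = 0
qint q (suc m) = 1 + q * qint q m

qfact : ℕ → ℕ → ℕ
qfact q zero = 1
qfact q (suc m) = qint q (suc m) * qfact q m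

qfact-nz : ∀ q m → NonZero (qfact q m)
qfact-nz q zero = _
qfact-nz q (suc m) = m*n≢0 (qint q (suc m)) (qfact q m) {{_}} {{qfact-nz q m}}

qbinom : ℕ → ℕ → ℕ → ℕ
qbinom q m j = if m <ᵇ j then 0
  else _/_ (qfact q m) (qfact q j * qfact q (m ∸ j))
         {{m*n≢0 (qfact q j) (qfact q (m ∸ j)) {{qfact-nz q j}} {{qfact-nz q (m ∸ j)}}}}

qfactQuot : ℕ → ℕ → ℕ → ℕ
qfactQuot q a r = _/_ (qfact q a) (qfact q r) {{qfact-nz q r}}

-- The polynomials S^{(a)}_{n,k}(q)   (S q a n k; n = 0 is a junk value)

-- summand for index i (1 ≤ i ≤ k), given the previous row Sprev = S^{(a)}_{n-1,-}.
-- The exponent a-k+i is an integer; when it is negative the q-binomial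
-- vanishes, so the summand is 0.
Sterm : (q a k : ℕ) → (ℕ → ℕ) → ℕ → ℕ
Sterm q a k Sprev i = if (a + i) <ᵇ k then 0
  else q ^ ((a + i ∸ k) C 2) * qbinom q i (a + i ∸ k)
         * qfactQuot q a (k ∸ i) * Sprev i

S : (q a n k : ℕ) → ℕ
S q a zero k = 0
S q a (suc zero) k = if k ≡ᵇ a then 1 else 0
S q a (suc (suc m)) k = sum (map (λ j → Sterm q a k (S q a (suc m)) (suc j)) (upTo k))

-- Values 1..n are represented by Fin n (order-preservingly); each block is a
-- set, i.e. a Subset n; an ordered partition is a Vec of k blocks such that
-- every block is nonempty and every value lies in exactly a blocks
-- (so the multiset union of the blocks is {i^a}).

sumFin : ∀ m → (Fin m → ℕ) → ℕ
sumFin m f = sum (map f (allFin m))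

allVec : ∀ {A : Set} → List A → ∀ k → List (Vec A k)
allVec xs zero = [] ∷ []
allVec xs (suc k) = concatMap (λ x → map (x ∷_) (allVec xs k)) xs

allCandidates : ∀ k n → List (Vec (Subset n) k)
allCandidates k n = allVec (allVec (true ∷ false ∷ []) n) k

nonemptyᵇ : ∀ {n} → Subset n → Bool
nonemptyᵇ {n} B = any (λ i → lookup B i) (allFin n)

multiplicity : ∀ {k n} → Vec (Subset n) k → Fin n → ℕ
multiplicity {k} π i = sumFin k (λ j → if lookup (lookup π j) i then 1 else 0)

isOP : ∀ {k n} → ℕ → Vec (Subset n) k → Bool
isOP {k} {n} a π =
  all (λ j → nonemptyᵇ (lookup π j)) (allFin k) ∧
  all (λ i → multiplicity π i ≡ᵇ a) (allFin n)

isMinᵇ : ∀ {n} → Subset n → Fin n → Bool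
isMinᵇ {n} B y = lookup B y ∧ not (any (λ z → lookup B z ∧ (toℕ z <ᵇ toℕ y)) (allFin n))

inv : ∀ {k n} → Vec (Subset n) k → ℕ
inv {k} {n} π =
  sumFin k λ j → sumFin k λ l → sumFin n λ x → sumFin n λ y →
    if (toℕ j <ᵇ toℕ l) ∧ lookup (lookup π j) x ∧ isMinᵇ (lookup π l) y ∧ (toℕ y <ᵇ toℕ x)
    then 1 else 0

Mah : (q a n k : ℕ) → ℕ
Mah q a n k = sum (map (λ π → if isOP a π then q ^ inv π else 0) (allCandidates k n))

module Submission where

-- Remove the largest value n + 1 from an ordered partition of {1^a, ..., (n+1)^a} into k blocks
-- and discard the blocks that become empty: what remains is an ordered partition of
-- {1^a, ..., n^a} into some i ≤ k blocks, and the removed value accounts exactly for the inversions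
-- (n + 1, min B) with B a later block that was already nonempty.  Summing over the ways to put the
-- a copies of n + 1 back gives Mah_{a^(n+1),k} = ∑ᵢ c(k,a,i) Mah_{a^n,i}, where, if e = a + i - k
-- old blocks receive the new value, c(k,a,i) = q^(e choose 2) [i choose e]_q [k choose i]_q.
-- Multiplied by ([a]_q!)^(n+1) this becomes the recursion defining S^(a).

open import Defs
open import Data.Bool using (Bool; true; false; if_then_else_; _∧_; _∨_; not; T)
open import Data.Bool.Properties using (∨-assoc; ∧-assoc; ∧-zeroʳ; ∧-identityʳ; ∨-identityʳ)
open import Data.Bool.ListAction using (all; any; and; or)
open import Data.Fin using (Fin; toℕ) renaming (zero to fzero; suc to fsuc)
open import Data.Fin.Subset using (Subset) renaming (⊥ to ∅)
open import Data.List as List using (List; []; _∷_; concatMap; allFin; applyUpTo)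
open import Data.List.Properties using (map-tabulate)
open import Data.Nat using (ℕ; zero; suc; _+_; _*_; _∸_; _^_; _≤_; _<_; _<?_; _≤?_; _<ᵇ_; _≡ᵇ_; _/_; NonZero; z≤n; s≤s)
open import Data.Nat.Combinatorics using (_C_; nCk+nC[k+1]≡[n+1]C[k+1]; nC1≡n)
open import Data.Nat.DivMod using (m*n/n≡m)
open import Data.Nat.ListAction using (sum)
open import Data.Nat.Properties
open import Data.Nat.Tactic.RingSolver using (solve-∀)
open import Data.Product using (_×_; _,_; ∃)
open import Data.Unit using (tt)
open import Data.Vec as Vec using (Vec; []; _∷_; lookup; _∷ʳ_; zipWith; replicate; toList)
open import Data.Vec.Properties using (lookup-map; lookup-zipWith; lookup-replicate; map-∷ʳ)
open import Function using (_∘_)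
open import Relation.Binary.PropositionalEquality
open import Relation.Nullary using (yes; no; ¬_; contradiction)
open ≡-Reasoning
open import Algebra.Properties.CommutativeSemigroup +-commutativeSemigroup using ()
  renaming (interchange to +-interchange)
open import Algebra.Properties.CommutativeSemigroup *-commutativeSemigroup using ()
  renaming (x∙yz≈y∙xz to x*[y*z]≡y*[x*z]; x∙yz≈xz∙y to x*[y*z]≡xz*y)

private variable A B : Set

infix 5 ∑ ∑<

∑ : List A → (A → ℕ) → ℕ
∑ []       f = 0
∑ (x ∷ xs) f = f x + ∑ xs f

syntax ∑ xs (λ x → e) = ∑[ x ∈ xs ] e

sum-map≡∑ : (f : A → ℕ) (xs : List A) → sum (List.map f xs) ≡ ∑ xs f
sum-map≡∑ f []       = refl
sum-map≡∑ f (x ∷ xs) = cong (f x +_) (sum-map≡∑ f xs)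

∑-cong : (xs : List A) {f g : A → ℕ} → (∀ x → f x ≡ g x) → ∑ xs f ≡ ∑ xs g
∑-cong []       f≗g = refl
∑-cong (x ∷ xs) f≗g = cong₂ _+_ (f≗g x) (∑-cong xs f≗g)

∑-++ : (xs ys : List A) (f : A → ℕ) → ∑ (xs List.++ ys) f ≡ ∑ xs f + ∑ ys f
∑-++ []       ys f = refl
∑-++ (x ∷ xs) ys f = trans (cong (f x +_) (∑-++ xs ys f)) (sym (+-assoc (f x) _ _))

∑-map : (h : A → B) (xs : List A) (f : B → ℕ) → ∑ (List.map h xs) f ≡ (∑[ x ∈ xs ] f (h x))
∑-map h []       f = refl
∑-map h (x ∷ xs) f = cong (f (h x) +_) (∑-map h xs f)

∑-concatMap : (g : A → List B) (xs : List A) (f : B → ℕ) →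
              ∑ (concatMap g xs) f ≡ (∑[ x ∈ xs ] ∑ (g x) f)
∑-concatMap g []       f = refl
∑-concatMap g (x ∷ xs) f = trans (∑-++ (g x) _ f) (cong (∑ (g x) f +_) (∑-concatMap g xs f))

∑-zero : (xs : List A) → (∑[ x ∈ xs ] 0) ≡ 0
∑-zero []       = refl
∑-zero (x ∷ xs) = ∑-zero xs

∑-distrib-+ : (xs : List A) (f g : A → ℕ) → (∑[ x ∈ xs ] f x + g x) ≡ ∑ xs f + ∑ xs g
∑-distrib-+ []       f g = refl
∑-distrib-+ (x ∷ xs) f g =
  trans (cong (f x + g x +_) (∑-distrib-+ xs f g)) (+-interchange (f x) (g x) _ _)

*-distribˡ-∑ : (c : ℕ) (xs : List A) (f : A → ℕ) → c * ∑ xs f ≡ (∑[ x ∈ xs ] c * f x)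
*-distribˡ-∑ c []       f = *-zeroʳ c
*-distribˡ-∑ c (x ∷ xs) f = trans (*-distribˡ-+ c (f x) _) (cong (c * f x +_) (*-distribˡ-∑ c xs f))

∑-comm : (xs : List A) (ys : List B) (f : A → B → ℕ) →
         (∑[ x ∈ xs ] ∑[ y ∈ ys ] f x y) ≡ (∑[ y ∈ ys ] ∑[ x ∈ xs ] f x y)
∑-comm []       ys f = sym (∑-zero ys)
∑-comm (x ∷ xs) ys f = trans (cong (∑ ys (f x) +_) (∑-comm xs ys f))
                             (sym (∑-distrib-+ ys (f x) (λ y → ∑[ x′ ∈ xs ] f x′ y)))

∑-comm-factors : ∀ (xs : List A) (ys : List B) (f : A → ℕ) (g : B → ℕ) (h : A → B → ℕ) →
  (∑[ x ∈ xs ] f x * (∑[ y ∈ ys ] g y * h x y)) ≡ (∑[ y ∈ ys ] g y * (∑[ x ∈ xs ] f x * h x y))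
∑-comm-factors xs ys f g h = begin
  (∑[ x ∈ xs ] f x * (∑[ y ∈ ys ] g y * h x y))
    ≡⟨ ∑-cong xs (λ x → *-distribˡ-∑ (f x) ys _) ⟩
  (∑[ x ∈ xs ] ∑[ y ∈ ys ] f x * (g y * h x y))
    ≡⟨ ∑-comm xs ys _ ⟩
  (∑[ y ∈ ys ] ∑[ x ∈ xs ] f x * (g y * h x y))
    ≡⟨ ∑-cong ys (λ y → ∑-cong xs (λ x → x*[y*z]≡y*[x*z] (f x) (g y) (h x y))) ⟩
  (∑[ y ∈ ys ] ∑[ x ∈ xs ] g y * (f x * h x y))
    ≡⟨ ∑-cong ys (λ y → sym (*-distribˡ-∑ (g y) xs _)) ⟩
  (∑[ y ∈ ys ] g y * (∑[ x ∈ xs ] f x * h x y)) ∎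

∑-allVec-suc : ∀ (xs : List A) k (f : Vec A (suc k) → ℕ) →
               ∑ (allVec xs (suc k)) f ≡ (∑[ x ∈ xs ] ∑[ v ∈ allVec xs k ] f (x ∷ v))
∑-allVec-suc xs k f = trans (∑-concatMap _ xs f) (∑-cong xs (λ x → ∑-map (x ∷_) (allVec xs k) f))

∑-allVec-∷ʳ : ∀ (xs : List A) n (f : Vec A (suc n) → ℕ) →
              ∑ (allVec xs (suc n)) f ≡ (∑[ v ∈ allVec xs n ] ∑[ x ∈ xs ] f (v ∷ʳ x))
∑-allVec-∷ʳ xs zero    f = trans (∑-allVec-suc xs 0 f) (trans (∑-cong xs (λ x → +-identityʳ (f (x ∷ [])))) (sym (+-identityʳ _)))
∑-allVec-∷ʳ xs (suc n) f = begin
  ∑ (allVec xs (suc (suc n))) f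
    ≡⟨ ∑-allVec-suc xs (suc n) f ⟩
  (∑[ x ∈ xs ] ∑[ v ∈ allVec xs (suc n) ] f (x ∷ v))
    ≡⟨ ∑-cong xs (λ x → ∑-allVec-∷ʳ xs n (f ∘ (x ∷_))) ⟩
  (∑[ x ∈ xs ] ∑[ v ∈ allVec xs n ] ∑[ y ∈ xs ] f (x ∷ (v ∷ʳ y)))
    ≡⟨ sym (∑-allVec-suc xs n _) ⟩
  (∑[ v ∈ allVec xs (suc n) ] ∑[ y ∈ xs ] f (v ∷ʳ y)) ∎

∑< : ℕ → (ℕ → ℕ) → ℕ
∑< zero    f = 0
∑< (suc n) f = f 0 + ∑< n (f ∘ suc)

syntax ∑< n (λ i → e) = ∑[ i < n ] e

∑<-cong : ∀ n {f g : ℕ → ℕ} → (∀ i → i < n → f i ≡ g i) → ∑< n f ≡ ∑< n g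
∑<-cong zero    f≗g = refl
∑<-cong (suc n) f≗g = cong₂ _+_ (f≗g 0 (s≤s z≤n)) (∑<-cong n (λ i i<n → f≗g (suc i) (s≤s i<n)))

∑<-zero : ∀ n → (∑[ i < n ] 0) ≡ 0
∑<-zero zero    = refl
∑<-zero (suc n) = ∑<-zero n

∑<-distrib-+ : ∀ n f g → (∑[ i < n ] f i + g i) ≡ ∑< n f + ∑< n g
∑<-distrib-+ zero    f g = refl
∑<-distrib-+ (suc n) f g =
  trans (cong (f 0 + g 0 +_) (∑<-distrib-+ n (f ∘ suc) (g ∘ suc))) (+-interchange (f 0) (g 0) _ _)

∑<-suc : ∀ n f → ∑< (suc n) f ≡ ∑< n f + f n
∑<-suc zero    f = +-identityʳ (f 0)
∑<-suc (suc n) f = trans (cong (f 0 +_) (∑<-suc n (f ∘ suc))) (sym (+-assoc (f 0) _ _))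

*-distribˡ-∑< : ∀ n c f → c * ∑< n f ≡ (∑[ i < n ] c * f i)
*-distribˡ-∑< zero    c f = *-zeroʳ c
*-distribˡ-∑< (suc n) c f = trans (*-distribˡ-+ c (f 0) _) (cong (c * f 0 +_) (*-distribˡ-∑< n c (f ∘ suc)))

*-distribʳ-∑< : ∀ n c f → ∑< n f * c ≡ (∑[ i < n ] f i * c)
*-distribʳ-∑< zero    c f = refl
*-distribʳ-∑< (suc n) c f = trans (*-distribʳ-+ c (f 0) _) (cong (f 0 * c +_) (*-distribʳ-∑< n c (f ∘ suc)))

∑<-shift : ∀ n f → f (suc n) ≡ 0 → ∑< (suc n) f ≡ f 0 + ∑< (suc n) (f ∘ suc)
∑<-shift n f last≡0 = begin
  ∑< (suc n) f                ≡⟨ sym (+-identityʳ _) ⟩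
  ∑< (suc n) f + 0            ≡⟨ cong (∑< (suc n) f +_) (sym last≡0) ⟩
  ∑< (suc n) f + f (suc n)    ≡⟨ sym (∑<-suc (suc n) f) ⟩
  f 0 + ∑< (suc n) (f ∘ suc)  ∎

sum-map-applyUpTo≡∑< : ∀ (h g : ℕ → ℕ) n → sum (List.map h (applyUpTo g n)) ≡ (∑[ i < n ] h (g i))
sum-map-applyUpTo≡∑< h g zero    = refl
sum-map-applyUpTo≡∑< h g (suc n) = cong (h (g 0) +_) (sum-map-applyUpTo≡∑< h (g ∘ suc) n)

-- Ordered partitions as lists of blocks

χ : Bool → ℕ
χ b = if b then 1 else 0

χ-∧ : ∀ x y → χ (x ∧ y) ≡ χ x * χ y
χ-∧ true  y = sym (+-identityʳ (χ y))
χ-∧ false y = refl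

size : ∀ {n} → Subset n → ℕ
size []      = 0
size (b ∷ r) = χ b + size r

nonempty : ∀ {n} → Subset n → Bool
nonempty []      = false
nonempty (b ∷ r) = b ∨ nonempty r

-- The number of x ∈ r with x > min s: the inversions between a block r and a later block s.
aboveMin : ∀ {n} → Subset n → Subset n → ℕ
aboveMin []      []      = 0
aboveMin (_ ∷ r) (c ∷ s) = if c then size r else aboveMin r s

invRows : ∀ {n} → List (Subset n) → ℕ
invRows []      = 0
invRows (r ∷ P) = (∑[ s ∈ P ] aboveMin r s) + invRows P

allNonempty : ∀ {n} → List (Subset n) → Bool
allNonempty []      = true
allNonempty (r ∷ P) = nonempty r ∧ allNonempty P

multiplicities : ∀ {n} → List (Subset n) → Vec ℕ n
multiplicities []      = replicate _ 0
multiplicities (r ∷ P) = zipWith _+_ (Vec.map χ r) (multiplicities P)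

allEqualTo : ∀ {n} → ℕ → Vec ℕ n → Bool
allEqualTo a []      = true
allEqualTo a (m ∷ v) = (m ≡ᵇ a) ∧ allEqualTo a v

invWeight : ∀ {n} → ℕ → ℕ → List (Subset n) → ℕ
invWeight q a P = χ (allEqualTo a (multiplicities P)) * q ^ invRows P

weight : ∀ {n} → ℕ → ℕ → List (Subset n) → ℕ
weight q a P = χ (allNonempty P) * invWeight q a P

bits : List Bool
bits = true ∷ false ∷ []

subsets : ∀ n → List (Subset n)
subsets n = allVec bits n

MahRows : ℕ → ℕ → ℕ → ℕ → ℕ
MahRows q a n k = ∑[ π ∈ allVec (subsets n) k ] weight q a (toList π)

map-allFin-suc : ∀ n (f : Fin (suc n) → A) →
                 List.map f (allFin (suc n)) ≡ f fzero ∷ List.map (f ∘ fsuc) (allFin n)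
map-allFin-suc n f =
  trans (map-tabulate (λ x → x) f) (cong (f fzero ∷_) (sym (map-tabulate (λ x → x) (f ∘ fsuc))))

sumFin-suc : ∀ n f → sumFin (suc n) f ≡ f fzero + sumFin n (f ∘ fsuc)
sumFin-suc n f = cong sum (map-allFin-suc n f)

sumFin-cong : ∀ n {f g : Fin n → ℕ} → (∀ x → f x ≡ g x) → sumFin n f ≡ sumFin n g
sumFin-cong n {f} {g} f≗g =
  trans (sum-map≡∑ f (allFin n)) (trans (∑-cong (allFin n) f≗g) (sym (sum-map≡∑ g (allFin n))))

sumFin-zero : ∀ n → sumFin n (λ _ → 0) ≡ 0
sumFin-zero n = trans (sum-map≡∑ (λ _ → 0) (allFin n)) (∑-zero (allFin n))

all-allFin-suc : ∀ n (p : Fin (suc n) → Bool) → all p (allFin (suc n)) ≡ p fzero ∧ all (p ∘ fsuc) (allFin n)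
all-allFin-suc n p = cong and (map-allFin-suc n p)

any-allFin-suc : ∀ n (p : Fin (suc n) → Bool) → any p (allFin (suc n)) ≡ p fzero ∨ any (p ∘ fsuc) (allFin n)
any-allFin-suc n p = cong or (map-allFin-suc n p)

all-cong : (xs : List A) {p p′ : A → Bool} → (∀ x → p x ≡ p′ x) → all p xs ≡ all p′ xs
all-cong []       p≗p′ = refl
all-cong (x ∷ xs) p≗p′ = cong₂ _∧_ (p≗p′ x) (all-cong xs p≗p′)

any-cong : (xs : List A) {p p′ : A → Bool} → (∀ x → p x ≡ p′ x) → any p xs ≡ any p′ xs
any-cong []       p≗p′ = refl
any-cong (x ∷ xs) p≗p′ = cong₂ _∨_ (p≗p′ x) (any-cong xs p≗p′)

any-const-false : (xs : List A) → any (λ _ → false) xs ≡ false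
any-const-false []       = refl
any-const-false (x ∷ xs) = any-const-false xs

size≡sumFin : ∀ {n} (r : Subset n) → size r ≡ sumFin n (χ ∘ lookup r)
size≡sumFin []          = refl
size≡sumFin {suc n} (b ∷ r) = trans (cong (χ b +_) (size≡sumFin r)) (sym (sumFin-suc n (χ ∘ lookup (b ∷ r))))

nonemptyᵇ≡nonempty : ∀ {n} (r : Subset n) → nonemptyᵇ r ≡ nonempty r
nonemptyᵇ≡nonempty []          = refl
nonemptyᵇ≡nonempty {suc n} (b ∷ r) = trans (any-allFin-suc n (lookup (b ∷ r))) (cong (b ∨_) (nonemptyᵇ≡nonempty r))

all-nonemptyᵇ≡allNonempty : ∀ {k n} (π : Vec (Subset n) k) →
                            all (nonemptyᵇ ∘ lookup π) (allFin k) ≡ allNonempty (toList π)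
all-nonemptyᵇ≡allNonempty []          = refl
all-nonemptyᵇ≡allNonempty {suc k} (r ∷ π) =
  trans (all-allFin-suc k (nonemptyᵇ ∘ lookup (r ∷ π))) (cong₂ _∧_ (nonemptyᵇ≡nonempty r) (all-nonemptyᵇ≡allNonempty π))

multiplicity≡lookup-multiplicities : ∀ {k n} (π : Vec (Subset n) k) i →
                                     multiplicity π i ≡ lookup (multiplicities (toList π)) i
multiplicity≡lookup-multiplicities []          i = sym (lookup-replicate i 0)
multiplicity≡lookup-multiplicities {suc k} (r ∷ π) i = begin
  multiplicity (r ∷ π) i                      ≡⟨ sumFin-suc k _ ⟩
  χ (lookup r i) + multiplicity π i           ≡⟨ cong₂ _+_ (sym (lookup-map i χ r)) (multiplicity≡lookup-multiplicities π i) ⟩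
  lookup (Vec.map χ r) i + lookup ms i        ≡⟨ sym (lookup-zipWith _+_ i (Vec.map χ r) ms) ⟩
  lookup (multiplicities (toList (r ∷ π))) i  ∎
  where ms = multiplicities (toList π)

all-lookup≡allEqualTo : ∀ {n} a (v : Vec ℕ n) → all (λ i → lookup v i ≡ᵇ a) (allFin n) ≡ allEqualTo a v
all-lookup≡allEqualTo a []          = refl
all-lookup≡allEqualTo {suc n} a (m ∷ v) =
  trans (all-allFin-suc n (λ i → lookup (m ∷ v) i ≡ᵇ a)) (cong ((m ≡ᵇ a) ∧_) (all-lookup≡allEqualTo a v))

isOP≡ : ∀ {k n} a (π : Vec (Subset n) k) →
        isOP a π ≡ allNonempty (toList π) ∧ allEqualTo a (multiplicities (toList π))
isOP≡ {k} {n} a π = cong₂ _∧_ (all-nonemptyᵇ≡allNonempty π)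
  (trans (all-cong (allFin n) (λ i → cong (_≡ᵇ a) (multiplicity≡lookup-multiplicities π i)))
         (all-lookup≡allEqualTo a (multiplicities (toList π))))

isMinᵇ-zero : ∀ {n} c (s : Subset n) → isMinᵇ (c ∷ s) fzero ≡ c
isMinᵇ-zero {n} c s = begin
  c ∧ not (any (λ z → lookup (c ∷ s) z ∧ false) (allFin (suc n)))
    ≡⟨ cong (λ t → c ∧ not t) (trans (any-cong (allFin (suc n)) (λ z → ∧-zeroʳ (lookup (c ∷ s) z)))
                                     (any-const-false (allFin (suc n)))) ⟩
  c ∧ true ≡⟨ ∧-identityʳ c ⟩
  c        ∎

isMinᵇ-suc : ∀ {n} c (s : Subset n) y → isMinᵇ (c ∷ s) (fsuc y) ≡ (if c then false else isMinᵇ s y)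
isMinᵇ-suc {n} c s y = trans (cong (λ t → lookup s y ∧ not t) (any-allFin-suc n _)) (by-cases c)
  where
  smaller = any (λ z → lookup s z ∧ (toℕ z <ᵇ toℕ y)) (allFin n)
  by-cases : ∀ c → lookup s y ∧ not ((c ∧ true) ∨ smaller) ≡ (if c then false else isMinᵇ s y)
  by-cases true  = ∧-zeroʳ (lookup s y)
  by-cases false = refl

pairsAboveMin : ∀ {n} → Subset n → Subset n → ℕ
pairsAboveMin {n} r s = sumFin n λ x → sumFin n λ y → χ (lookup r x ∧ isMinᵇ s y ∧ (toℕ y <ᵇ toℕ x))

pairsAboveMin-∷ : ∀ {n} b c (r s : Subset n) →
  pairsAboveMin (b ∷ r) (c ∷ s) ≡
  sumFin n (λ x → χ (lookup r x ∧ c) + sumFin n (λ y → χ (lookup r x ∧ isMinᵇ (c ∷ s) (fsuc y) ∧ (toℕ y <ᵇ toℕ x))))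
pairsAboveMin-∷ {n} b c r s = begin
  pairsAboveMin (b ∷ r) (c ∷ s)
    ≡⟨ sumFin-suc n _ ⟩
  sumFin (suc n) (λ y → χ (b ∧ isMinᵇ (c ∷ s) y ∧ false)) + sumFin n (λ x → sumFin (suc n) (term x))
    ≡⟨ cong₂ _+_ (trans (sumFin-cong (suc n) (λ y → cong χ (nothing-below-zero y))) (sumFin-zero (suc n)))
                 (sumFin-cong n (λ x → trans (sumFin-suc n (term x))
                   (cong (_+ sumFin n (term x ∘ fsuc))
                         (cong (λ t → χ (lookup r x ∧ t)) (trans (∧-identityʳ _) (isMinᵇ-zero c s)))))) ⟩
  0 + sumFin n (λ x → χ (lookup r x ∧ c) + sumFin n (term x ∘ fsuc)) ∎
  where
  term : Fin n → Fin (suc n) → ℕ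
  term x y = χ (lookup r x ∧ isMinᵇ (c ∷ s) y ∧ (toℕ y <ᵇ suc (toℕ x)))
  nothing-below-zero : ∀ y → b ∧ isMinᵇ (c ∷ s) y ∧ false ≡ false
  nothing-below-zero y = trans (cong (b ∧_) (∧-zeroʳ _)) (∧-zeroʳ b)

pairsAboveMin≡aboveMin : ∀ {n} (r s : Subset n) → pairsAboveMin r s ≡ aboveMin r s
pairsAboveMin≡aboveMin []      []          = refl
pairsAboveMin≡aboveMin {suc n} (b ∷ r) (true ∷ s) = begin
  pairsAboveMin (b ∷ r) (true ∷ s)
    ≡⟨ pairsAboveMin-∷ b true r s ⟩
  sumFin n (λ x → χ (lookup r x ∧ true) + sumFin n (λ y → χ (lookup r x ∧ isMinᵇ (true ∷ s) (fsuc y) ∧ _)))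
    ≡⟨ sumFin-cong n (λ x → cong₂ _+_ (cong χ (∧-identityʳ (lookup r x))) (no-other-min x)) ⟩
  sumFin n (λ x → χ (lookup r x) + 0)
    ≡⟨ trans (sumFin-cong n (λ x → +-identityʳ _)) (sym (size≡sumFin r)) ⟩
  size r ∎
  where
  no-other-min : ∀ x → sumFin n (λ y → χ (lookup r x ∧ isMinᵇ (true ∷ s) (fsuc y) ∧ (toℕ y <ᵇ toℕ x))) ≡ 0
  no-other-min x = trans (sumFin-cong n (λ y → cong (λ t → χ (lookup r x ∧ t ∧ _)) (isMinᵇ-suc true s y)))
                         (trans (sumFin-cong n (λ y → cong χ (∧-zeroʳ (lookup r x)))) (sumFin-zero n))
pairsAboveMin≡aboveMin {suc n} (b ∷ r) (false ∷ s) = begin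
  pairsAboveMin (b ∷ r) (false ∷ s)
    ≡⟨ pairsAboveMin-∷ b false r s ⟩
  sumFin n (λ x → χ (lookup r x ∧ false) + sumFin n (λ y → χ (lookup r x ∧ isMinᵇ (false ∷ s) (fsuc y) ∧ _)))
    ≡⟨ sumFin-cong n (λ x → cong₂ _+_ (cong χ (∧-zeroʳ (lookup r x)))
                                      (sumFin-cong n (λ y → cong (λ t → χ (lookup r x ∧ t ∧ _)) (isMinᵇ-suc false s y)))) ⟩
  pairsAboveMin r s
    ≡⟨ pairsAboveMin≡aboveMin r s ⟩
  aboveMin r s ∎

invTable : ∀ {k n} → Vec (Subset n) k → ℕ
invTable {k} π = sumFin k λ j → sumFin k λ l → if toℕ j <ᵇ toℕ l then aboveMin (lookup π j) (lookup π l) else 0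

invTable≡invRows : ∀ {k n} (π : Vec (Subset n) k) → invTable π ≡ invRows (toList π)
invTable≡invRows []          = refl
invTable≡invRows {suc k} (r ∷ π) = begin
  invTable (r ∷ π)
    ≡⟨ sumFin-suc k _ ⟩
  _ ≡⟨ cong₂ _+_ (sumFin-suc k (λ l → if 0 <ᵇ toℕ l then aboveMin r (lookup (r ∷ π) l) else 0))
                 (sumFin-cong k (λ j → sumFin-suc k (λ l → if suc (toℕ j) <ᵇ toℕ l
                                                              then aboveMin (lookup π j) (lookup (r ∷ π) l) else 0))) ⟩
  sumFin k (λ l → aboveMin r (lookup π l)) + invTable π
    ≡⟨ cong₂ _+_ (sumFin-aboveMin r π) (invTable≡invRows π) ⟩
  invRows (toList (r ∷ π)) ∎
  where
  sumFin-aboveMin : ∀ {k} r (π : Vec (Subset _) k) → sumFin k (aboveMin r ∘ lookup π) ≡ ∑[ s ∈ toList π ] aboveMin r s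
  sumFin-aboveMin r []          = refl
  sumFin-aboveMin {suc k} r (s ∷ π) = trans (sumFin-suc k _) (cong (aboveMin r s +_) (sumFin-aboveMin r π))

inv≡invRows : ∀ {k n} (π : Vec (Subset n) k) → inv π ≡ invRows (toList π)
inv≡invRows {k} {n} π = trans (sumFin-cong k (λ j → sumFin-cong k (λ l → entry (toℕ j <ᵇ toℕ l) j l))) (invTable≡invRows π)
  where
  entry : ∀ t j l →
          (sumFin n λ x → sumFin n λ y → χ (t ∧ lookup (lookup π j) x ∧ isMinᵇ (lookup π l) y ∧ (toℕ y <ᵇ toℕ x)))
          ≡ (if t then aboveMin (lookup π j) (lookup π l) else 0)
  entry true  j l = pairsAboveMin≡aboveMin (lookup π j) (lookup π l)
  entry false j l = trans (sumFin-cong n (λ x → sumFin-zero n)) (sumFin-zero n)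

Mah≡MahRows : ∀ q a n k → Mah q a n k ≡ MahRows q a n k
Mah≡MahRows q a n k = trans (sum-map≡∑ _ (allVec (subsets n) k)) (∑-cong (allVec (subsets n) k) λ π →
  begin
    (if isOP a π then q ^ inv π else 0)
      ≡⟨ cong₂ (λ b i → if b then q ^ i else 0) (isOP≡ a π) (inv≡invRows π) ⟩
    (if allNonempty (toList π) ∧ allEqualTo a (multiplicities (toList π)) then q ^ invRows (toList π) else 0)
      ≡⟨ if-∧≡χ*χ* (allNonempty (toList π)) _ (q ^ invRows (toList π)) ⟩
    weight q a (toList π) ∎)
  where
  if-∧≡χ*χ* : ∀ x y z → (if x ∧ y then z else 0) ≡ χ x * (χ y * z)
  if-∧≡χ*χ* true  true  z = sym (trans (+-identityʳ _) (+-identityʳ z))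
  if-∧≡χ*χ* true  false z = refl
  if-∧≡χ*χ* false y     z = refl

-- Inserting the largest value n + 1 into the blocks flagged by a column c

extend : ∀ {k n} → Vec (Subset n) k → Vec Bool k → Vec (Subset (suc n)) k
extend = zipWith _∷ʳ_

∑-subsets-suc : ∀ {n} k (f : Vec (Subset (suc n)) k → ℕ) →
  ∑ (allVec (subsets (suc n)) k) f ≡ (∑[ π ∈ allVec (subsets n) k ] ∑[ c ∈ allVec bits k ] f (extend π c))
∑-subsets-suc zero    f = sym (+-identityʳ _)
∑-subsets-suc {n} (suc k) f = begin
  ∑ (allVec (subsets (suc n)) (suc k)) f
    ≡⟨ ∑-allVec-suc (subsets (suc n)) k f ⟩
  (∑[ r ∈ subsets (suc n) ] ∑[ π ∈ allVec (subsets (suc n)) k ] f (r ∷ π))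
    ≡⟨ ∑-cong (subsets (suc n)) (λ r → ∑-subsets-suc k (f ∘ (r ∷_))) ⟩
  (∑[ r ∈ subsets (suc n) ] ∑[ π ∈ allVec (subsets n) k ] ∑[ c ∈ allVec bits k ] f (r ∷ extend π c))
    ≡⟨ ∑-allVec-∷ʳ bits n _ ⟩
  (∑[ v ∈ subsets n ] ∑[ b ∈ bits ] ∑[ π ∈ allVec (subsets n) k ] ∑[ c ∈ allVec bits k ] f ((v ∷ʳ b) ∷ extend π c))
    ≡⟨ ∑-cong (subsets n) (λ v → ∑-comm bits (allVec (subsets n) k)
                                         (λ b π → ∑[ c ∈ allVec bits k ] f ((v ∷ʳ b) ∷ extend π c))) ⟩
  (∑[ v ∈ subsets n ] ∑[ π ∈ allVec (subsets n) k ] ∑[ b ∈ bits ] ∑[ c ∈ allVec bits k ] f ((v ∷ʳ b) ∷ extend π c))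
    ≡⟨ ∑-cong (subsets n) (λ v → ∑-cong (allVec (subsets n) k) (λ π → sym (∑-allVec-suc bits k (f ∘ extend (v ∷ π))))) ⟩
  (∑[ v ∈ subsets n ] ∑[ π ∈ allVec (subsets n) k ] ∑[ c ∈ allVec bits (suc k) ] f (extend (v ∷ π) c))
    ≡⟨ sym (∑-allVec-suc (subsets n) k _) ⟩
  (∑[ π ∈ allVec (subsets n) (suc k) ] ∑[ c ∈ allVec bits (suc k) ] f (extend π c)) ∎

nonempty-∷ʳ : ∀ {n} (r : Subset n) b → nonempty (r ∷ʳ b) ≡ nonempty r ∨ b
nonempty-∷ʳ []      b = ∨-identityʳ b
nonempty-∷ʳ (x ∷ r) b = trans (cong (x ∨_) (nonempty-∷ʳ r b)) (sym (∨-assoc x (nonempty r) b))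

size-∷ʳ : ∀ {n} (r : Subset n) b → size (r ∷ʳ b) ≡ size r + χ b
size-∷ʳ []      b = +-identityʳ (χ b)
size-∷ʳ (x ∷ r) b = trans (cong (χ x +_) (size-∷ʳ r b)) (sym (+-assoc (χ x) (size r) (χ b)))

aboveMin-∷ʳ : ∀ {n} (r s : Subset n) b c → aboveMin (r ∷ʳ b) (s ∷ʳ c) ≡ aboveMin r s + χ b * χ (nonempty s)
aboveMin-∷ʳ []      []          b true  = sym (*-zeroʳ (χ b))
aboveMin-∷ʳ []      []          b false = sym (*-zeroʳ (χ b))
aboveMin-∷ʳ (x ∷ r) (true  ∷ s) b c     = trans (size-∷ʳ r b) (cong (size r +_) (sym (*-identityʳ (χ b))))
aboveMin-∷ʳ (x ∷ r) (false ∷ s) b c     = aboveMin-∷ʳ r s b c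

nonemptyPattern : ∀ {k n} → Vec (Subset n) k → Vec Bool k
nonemptyPattern = Vec.map nonempty

∑-aboveMin-extend : ∀ {k n} (r : Subset n) b (π : Vec (Subset n) k) c →
  (∑[ s ∈ toList (extend π c) ] aboveMin (r ∷ʳ b) s) ≡ (∑[ s ∈ toList π ] aboveMin r s) + χ b * size (nonemptyPattern π)
∑-aboveMin-extend r b []      []       = sym (*-zeroʳ (χ b))
∑-aboveMin-extend r b (s ∷ π) (c ∷ cs) = begin
  aboveMin (r ∷ʳ b) (s ∷ʳ c) + (∑[ s′ ∈ toList (extend π cs) ] aboveMin (r ∷ʳ b) s′)
    ≡⟨ cong₂ _+_ (aboveMin-∷ʳ r s b c) (∑-aboveMin-extend r b π cs) ⟩
  aboveMin r s + χ b * χ (nonempty s) + ((∑[ s′ ∈ toList π ] aboveMin r s′) + χ b * size (nonemptyPattern π))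
    ≡⟨ +-interchange (aboveMin r s) _ _ _ ⟩
  aboveMin r s + (∑[ s′ ∈ toList π ] aboveMin r s′) + (χ b * χ (nonempty s) + χ b * size (nonemptyPattern π))
    ≡⟨ cong (aboveMin r s + (∑[ s′ ∈ toList π ] aboveMin r s′) +_) (sym (*-distribˡ-+ (χ b) _ _)) ⟩
  aboveMin r s + (∑[ s′ ∈ toList π ] aboveMin r s′) + χ b * size (nonemptyPattern (s ∷ π)) ∎

-- The new value, placed in block j, exceeds the minimum of every later block that is already nonempty.
newInversions : ∀ {k} → Vec Bool k → Vec Bool k → ℕ
newInversions []       []        = 0
newInversions (c ∷ cs) (_ ∷ pat) = χ c * size pat + newInversions cs pat

invRows-extend : ∀ {k n} (π : Vec (Subset n) k) c →
  invRows (toList (extend π c)) ≡ invRows (toList π) + newInversions c (nonemptyPattern π)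
invRows-extend []      []      = refl
invRows-extend (r ∷ π) (b ∷ c) =
  trans (cong₂ _+_ (∑-aboveMin-extend r b π c) (invRows-extend π c))
        (+-interchange (∑[ s ∈ toList π ] aboveMin r s) (χ b * size (nonemptyPattern π)) (invRows (toList π)) _)

allFilled : ∀ {k} → Vec Bool k → Vec Bool k → Bool
allFilled []        []       = true
allFilled (m ∷ pat) (c ∷ cs) = (m ∨ c) ∧ allFilled pat cs

allNonempty-extend : ∀ {k n} (π : Vec (Subset n) k) c → allNonempty (toList (extend π c)) ≡ allFilled (nonemptyPattern π) c
allNonempty-extend []      []      = refl
allNonempty-extend (r ∷ π) (b ∷ c) = cong₂ _∧_ (nonempty-∷ʳ r b) (allNonempty-extend π c)

replicate-suc : ∀ n (x : A) → replicate (suc n) x ≡ replicate n x ∷ʳ x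
replicate-suc zero    x = refl
replicate-suc (suc n) x = cong (x ∷_) (replicate-suc n x)

zipWith-∷ʳ : ∀ {C : Set} {n} (f : A → B → C) (v : Vec A n) (w : Vec B n) x y →
             zipWith f (v ∷ʳ x) (w ∷ʳ y) ≡ zipWith f v w ∷ʳ f x y
zipWith-∷ʳ f []      []      x y = refl
zipWith-∷ʳ f (a ∷ v) (b ∷ w) x y = cong (f a b ∷_) (zipWith-∷ʳ f v w x y)

multiplicities-extend : ∀ {k n} (π : Vec (Subset n) k) c →
  multiplicities (toList (extend π c)) ≡ multiplicities (toList π) ∷ʳ size c
multiplicities-extend {n = n} [] [] = replicate-suc n 0
multiplicities-extend (r ∷ π) (b ∷ c) = begin
  zipWith _+_ (Vec.map χ (r ∷ʳ b)) (multiplicities (toList (extend π c)))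
    ≡⟨ cong₂ (zipWith _+_) (map-∷ʳ χ b r) (multiplicities-extend π c) ⟩
  zipWith _+_ (Vec.map χ r ∷ʳ χ b) (multiplicities (toList π) ∷ʳ size c)
    ≡⟨ zipWith-∷ʳ _+_ (Vec.map χ r) (multiplicities (toList π)) (χ b) (size c) ⟩
  multiplicities (toList (r ∷ π)) ∷ʳ size (b ∷ c) ∎

allEqualTo-∷ʳ : ∀ {n} a (v : Vec ℕ n) m → allEqualTo a (v ∷ʳ m) ≡ allEqualTo a v ∧ (m ≡ᵇ a)
allEqualTo-∷ʳ a []      m = ∧-identityʳ (m ≡ᵇ a)
allEqualTo-∷ʳ a (x ∷ v) m = trans (cong ((x ≡ᵇ a) ∧_) (allEqualTo-∷ʳ a v m)) (sym (∧-assoc (x ≡ᵇ a) _ _))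

columnWeight : ∀ {k} → ℕ → ℕ → Vec Bool k → Vec Bool k → ℕ
columnWeight q a pat c = χ (allFilled pat c) * (χ (size c ≡ᵇ a) * q ^ newInversions c pat)

extensionWeight : ∀ {k} → ℕ → ℕ → Vec Bool k → ℕ
extensionWeight {k} q a pat = ∑[ c ∈ allVec bits k ] columnWeight q a pat c

weight-extend : ∀ {k n} q a (π : Vec (Subset n) k) c →
  weight q a (toList (extend π c)) ≡ invWeight q a (toList π) * columnWeight q a (nonemptyPattern π) c
weight-extend q a π c = begin
  weight q a (toList (extend π c))
    ≡⟨ cong₂ (λ u v → χ u * v) (allNonempty-extend π c)
         (cong₂ (λ u v → χ u * q ^ v)
                (trans (cong (allEqualTo a) (multiplicities-extend π c)) (allEqualTo-∷ʳ a (multiplicities (toList π)) (size c)))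
                (invRows-extend π c)) ⟩
  χ F * (χ (M ∧ (size c ≡ᵇ a)) * q ^ (I + N))
    ≡⟨ cong (χ F *_) (cong₂ _*_ (χ-∧ M (size c ≡ᵇ a)) (^-distribˡ-+-* q I N)) ⟩
  χ F * ((χ M * χ (size c ≡ᵇ a)) * (q ^ I * q ^ N))
    ≡⟨ shuffle (χ F) (χ M) (χ (size c ≡ᵇ a)) (q ^ I) (q ^ N) ⟩
  (χ M * q ^ I) * (χ F * (χ (size c ≡ᵇ a) * q ^ N)) ∎
  where
  F = allFilled (nonemptyPattern π) c
  M = allEqualTo a (multiplicities (toList π))
  I = invRows (toList π)
  N = newInversions c (nonemptyPattern π)
  shuffle : ∀ f m s x y → f * ((m * s) * (x * y)) ≡ (m * x) * (f * (s * y))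
  shuffle = solve-∀

dropEmpty : ∀ {k n} → Vec (Subset n) k → List (Subset n)
dropEmpty []      = []
dropEmpty (r ∷ π) = if nonempty r then r ∷ dropEmpty π else dropEmpty π

size-empty : ∀ {n} (r : Subset n) → nonempty r ≡ false → size r ≡ 0
size-empty []          _ = refl
size-empty (false ∷ r) e = size-empty r e

aboveMin-emptyˡ : ∀ {n} (r s : Subset n) → nonempty r ≡ false → aboveMin r s ≡ 0
aboveMin-emptyˡ []          []          _ = refl
aboveMin-emptyˡ (false ∷ r) (true  ∷ s) e = size-empty r e
aboveMin-emptyˡ (false ∷ r) (false ∷ s) e = aboveMin-emptyˡ r s e

aboveMin-emptyʳ : ∀ {n} (r s : Subset n) → nonempty s ≡ false → aboveMin r s ≡ 0
aboveMin-emptyʳ []      []          _ = refl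
aboveMin-emptyʳ (_ ∷ r) (false ∷ s) e = aboveMin-emptyʳ r s e

zipWith-+-empty : ∀ {n} (r : Subset n) v → nonempty r ≡ false → zipWith _+_ (Vec.map χ r) v ≡ v
zipWith-+-empty []          []      _ = refl
zipWith-+-empty (false ∷ r) (m ∷ v) e = cong (m ∷_) (zipWith-+-empty r v e)

∑-aboveMin-dropEmpty : ∀ {k n} (r : Subset n) (π : Vec (Subset n) k) →
                       (∑[ s ∈ dropEmpty π ] aboveMin r s) ≡ (∑[ s ∈ toList π ] aboveMin r s)
∑-aboveMin-dropEmpty r []      = refl
∑-aboveMin-dropEmpty r (s ∷ π) with nonempty s in eq
... | true  = cong (aboveMin r s +_) (∑-aboveMin-dropEmpty r π)
... | false = trans (∑-aboveMin-dropEmpty r π) (sym (cong (_+ _) (aboveMin-emptyʳ r s eq)))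

invRows-dropEmpty : ∀ {k n} (π : Vec (Subset n) k) → invRows (dropEmpty π) ≡ invRows (toList π)
invRows-dropEmpty []      = refl
invRows-dropEmpty (r ∷ π) with nonempty r in eq
... | true  = cong₂ _+_ (∑-aboveMin-dropEmpty r π) (invRows-dropEmpty π)
... | false = trans (invRows-dropEmpty π)
                    (sym (cong (_+ _) (trans (∑-cong (toList π) (λ s → aboveMin-emptyˡ r s eq)) (∑-zero (toList π)))))

multiplicities-dropEmpty : ∀ {k n} (π : Vec (Subset n) k) → multiplicities (dropEmpty π) ≡ multiplicities (toList π)
multiplicities-dropEmpty []      = refl
multiplicities-dropEmpty (r ∷ π) with nonempty r in eq
... | true  = cong (zipWith _+_ (Vec.map χ r)) (multiplicities-dropEmpty π)
... | false = trans (multiplicities-dropEmpty π) (sym (zipWith-+-empty r _ eq))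

invWeight-dropEmpty : ∀ {k n} q a (π : Vec (Subset n) k) → invWeight q a (dropEmpty π) ≡ invWeight q a (toList π)
invWeight-dropEmpty q a π =
  cong₂ (λ m i → χ (allEqualTo a m) * q ^ i) (multiplicities-dropEmpty π) (invRows-dropEmpty π)

MahRows-suc : ∀ q a n k → MahRows q a (suc n) k ≡
  (∑[ π ∈ allVec (subsets n) k ] invWeight q a (dropEmpty π) * extensionWeight q a (nonemptyPattern π))
MahRows-suc q a n k = trans (∑-subsets-suc k _) (∑-cong (allVec (subsets n) k) λ π → begin
  (∑[ c ∈ allVec bits k ] weight q a (toList (extend π c)))
    ≡⟨ ∑-cong (allVec bits k) (weight-extend q a π) ⟩
  (∑[ c ∈ allVec bits k ] invWeight q a (toList π) * columnWeight q a (nonemptyPattern π) c)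
    ≡⟨ sym (*-distribˡ-∑ (invWeight q a (toList π)) (allVec bits k) _) ⟩
  invWeight q a (toList π) * extensionWeight q a (nonemptyPattern π)
    ≡⟨ cong (_* extensionWeight q a (nonemptyPattern π)) (sym (invWeight-dropEmpty q a π)) ⟩
  invWeight q a (dropEmpty π) * extensionWeight q a (nonemptyPattern π) ∎)

nonempty-∅ : ∀ n → nonempty (∅ {n}) ≡ false
nonempty-∅ zero    = refl
nonempty-∅ (suc n) = nonempty-∅ n

∑-subsets-split : ∀ n (f : Subset n → ℕ) → ∑ (subsets n) f ≡ (∑[ r ∈ subsets n ] χ (nonempty r) * f r) + f ∅
∑-subsets-split zero    f = +-identityʳ (f [])
∑-subsets-split (suc n) f = begin
  ∑ (subsets (suc n)) f
    ≡⟨ ∑-allVec-suc bits n f ⟩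
  ∑ (subsets n) (f ∘ (true ∷_)) + (∑ (subsets n) (f ∘ (false ∷_)) + 0)
    ≡⟨ cong (∑ (subsets n) (f ∘ (true ∷_)) +_) (trans (+-identityʳ _) (∑-subsets-split n (f ∘ (false ∷_)))) ⟩
  ∑ (subsets n) (f ∘ (true ∷_)) + ((∑[ r ∈ subsets n ] χ (nonempty r) * f (false ∷ r)) + f ∅)
    ≡⟨ sym (+-assoc (∑ (subsets n) (f ∘ (true ∷_))) _ (f ∅)) ⟩
  ∑ (subsets n) (f ∘ (true ∷_)) + (∑[ r ∈ subsets n ] χ (nonempty r) * f (false ∷ r)) + f ∅
    ≡⟨ cong (_+ f ∅) (sym (trans (∑-allVec-suc bits n _) (cong₂ _+_ (∑-cong (subsets n) (λ r → +-identityʳ _)) (+-identityʳ _)))) ⟩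
  (∑[ r ∈ subsets (suc n) ] χ (nonempty r) * f r) + f ∅ ∎

sumNonempty : ∀ {n} → ℕ → (List (Subset n) → ℕ) → ℕ
sumNonempty {n} m G = ∑[ P ∈ allVec (subsets n) m ] χ (allNonempty (toList P)) * G (toList P)

sumNonempty-suc : ∀ {n} m (G : List (Subset n) → ℕ) →
  sumNonempty (suc m) G ≡ (∑[ r ∈ subsets n ] χ (nonempty r) * sumNonempty m (G ∘ (r ∷_)))
sumNonempty-suc {n} m G = begin
  sumNonempty (suc m) G
    ≡⟨ ∑-allVec-suc (subsets n) m _ ⟩
  (∑[ r ∈ subsets n ] ∑[ P ∈ allVec (subsets n) m ] χ (nonempty r ∧ allNonempty (toList P)) * G (r ∷ toList P))
    ≡⟨ ∑-cong (subsets n) (λ r → ∑-cong (allVec (subsets n) m) (λ P →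
         trans (cong (_* G (r ∷ toList P)) (χ-∧ (nonempty r) _)) (*-assoc (χ (nonempty r)) _ _))) ⟩
  (∑[ r ∈ subsets n ] ∑[ P ∈ allVec (subsets n) m ] χ (nonempty r) * (χ (allNonempty (toList P)) * G (r ∷ toList P)))
    ≡⟨ ∑-cong (subsets n) (λ r → sym (*-distribˡ-∑ (χ (nonempty r)) (allVec (subsets n) m) _)) ⟩
  (∑[ r ∈ subsets n ] χ (nonempty r) * sumNonempty m (G ∘ (r ∷_))) ∎

∑-by-nonemptyPattern : ∀ {n} k (G : List (Subset n) → ℕ) (h : Vec Bool k → ℕ) →
  (∑[ π ∈ allVec (subsets n) k ] G (dropEmpty π) * h (nonemptyPattern π))
  ≡ (∑[ pat ∈ allVec bits k ] h pat * sumNonempty (size pat) G)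
∑-by-nonemptyPattern zero G h =
  cong (_+ 0) (trans (*-comm (G []) (h [])) (cong (h [] *_) (sym (trans (+-identityʳ _) (*-identityˡ _)))))
∑-by-nonemptyPattern {n} (suc k) G h = begin
  (∑[ π ∈ allVec (subsets n) (suc k) ] G (dropEmpty π) * h (nonemptyPattern π))
    ≡⟨ ∑-allVec-suc (subsets n) k _ ⟩
  ∑ (subsets n) F
    ≡⟨ ∑-subsets-split n F ⟩
  (∑[ r ∈ subsets n ] χ (nonempty r) * F r) + F ∅
    ≡⟨ cong₂ _+_ (∑-cong (subsets n) F-nonempty) F-∅ ⟩
  (∑[ r ∈ subsets n ] χ (nonempty r) * (∑[ pat ∈ allVec bits k ] h (true ∷ pat) * sumNonempty (size pat) (G ∘ (r ∷_))))
    + (∑[ pat ∈ allVec bits k ] h (false ∷ pat) * sumNonempty (size pat) G)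
    ≡⟨ cong (_+ (∑[ pat ∈ allVec bits k ] h (false ∷ pat) * sumNonempty (size pat) G))
            (∑-comm-factors (subsets n) (allVec bits k) (χ ∘ nonempty) (h ∘ (true ∷_))
                            (λ r pat → sumNonempty (size pat) (G ∘ (r ∷_)))) ⟩
  (∑[ pat ∈ allVec bits k ] h (true ∷ pat) * (∑[ r ∈ subsets n ] χ (nonempty r) * sumNonempty (size pat) (G ∘ (r ∷_))))
    + (∑[ pat ∈ allVec bits k ] h (false ∷ pat) * sumNonempty (size pat) G)
    ≡⟨ cong₂ _+_ (∑-cong (allVec bits k) (λ pat → cong (h (true ∷ pat) *_) (sym (sumNonempty-suc (size pat) G))))
                 (sym (+-identityʳ _)) ⟩
  (∑[ pat ∈ allVec bits k ] h (true ∷ pat) * sumNonempty (suc (size pat)) G)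
    + ((∑[ pat ∈ allVec bits k ] h (false ∷ pat) * sumNonempty (size pat) G) + 0)
    ≡⟨ sym (∑-allVec-suc bits k _) ⟩
  (∑[ pat ∈ allVec bits (suc k) ] h pat * sumNonempty (size pat) G) ∎
  where
  F : Subset n → ℕ
  F r = ∑[ π ∈ allVec (subsets n) k ] G (dropEmpty (r ∷ π)) * h (nonempty r ∷ nonemptyPattern π)
  F-nonempty : ∀ r → χ (nonempty r) * F r
                     ≡ χ (nonempty r) * (∑[ pat ∈ allVec bits k ] h (true ∷ pat) * sumNonempty (size pat) (G ∘ (r ∷_)))
  F-nonempty r with nonempty r
  ... | true  = cong (_+ 0) (∑-by-nonemptyPattern k (G ∘ (r ∷_)) (h ∘ (true ∷_)))
  ... | false = refl
  F-∅ : F ∅ ≡ (∑[ pat ∈ allVec bits k ] h (false ∷ pat) * sumNonempty (size pat) G)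
  F-∅ rewrite nonempty-∅ n = ∑-by-nonemptyPattern k G (h ∘ (false ∷_))

MahRows-recursion : ∀ q a n k →
  MahRows q a (suc n) k ≡ (∑[ pat ∈ allVec bits k ] extensionWeight q a pat * MahRows q a n (size pat))
MahRows-recursion q a n k = trans (MahRows-suc q a n k) (∑-by-nonemptyPattern k (invWeight q a) (extensionWeight q a))

-- Collecting the patterns by their number of nonempty blocks

-- The extensions of a pattern b ∷ pat that put the new value into the first block;
-- their weight does not depend on b.
headWeight : ∀ {k} → ℕ → ℕ → Vec Bool k → ℕ
headWeight {k} q a pat = ∑[ c ∈ allVec bits k ] columnWeight q a (true ∷ pat) (true ∷ c)

extensionWeight-true∷ : ∀ {k} q a (pat : Vec Bool k) →
                        extensionWeight q a (true ∷ pat) ≡ headWeight q a pat + extensionWeight q a pat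
extensionWeight-true∷ {k} q a pat = trans (∑-allVec-suc bits k _) (cong (headWeight q a pat +_) (+-identityʳ _))

extensionWeight-false∷ : ∀ {k} q a (pat : Vec Bool k) → extensionWeight q a (false ∷ pat) ≡ headWeight q a pat
extensionWeight-false∷ {k} q a pat = begin
  extensionWeight q a (false ∷ pat)
    ≡⟨ ∑-allVec-suc bits k _ ⟩
  headWeight q a pat + ((∑[ c ∈ allVec bits k ] 0) + 0)
    ≡⟨ cong (headWeight q a pat +_) (trans (+-identityʳ _) (∑-zero (allVec bits k))) ⟩
  headWeight q a pat + 0
    ≡⟨ +-identityʳ _ ⟩
  headWeight q a pat ∎

headWeight-zero : ∀ {k} q (pat : Vec Bool k) → headWeight q zero pat ≡ 0
headWeight-zero {k} q pat = trans (∑-cong (allVec bits k) (λ c → *-zeroʳ (χ (allFilled pat c)))) (∑-zero (allVec bits k))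

headWeight-suc : ∀ {k} q a (pat : Vec Bool k) → headWeight q (suc a) pat ≡ q ^ size pat * extensionWeight q a pat
headWeight-suc {k} q a pat = trans (∑-cong (allVec bits k) λ c → begin
    χ (allFilled pat c) * (χ (size c ≡ᵇ a) * q ^ (size pat + 0 + newInversions c pat))
      ≡⟨ cong (λ e → χ (allFilled pat c) * (χ (size c ≡ᵇ a) * q ^ (e + newInversions c pat))) (+-identityʳ (size pat)) ⟩
    χ (allFilled pat c) * (χ (size c ≡ᵇ a) * q ^ (size pat + newInversions c pat))
      ≡⟨ cong (λ e → χ (allFilled pat c) * (χ (size c ≡ᵇ a) * e)) (^-distribˡ-+-* q (size pat) _) ⟩
    χ (allFilled pat c) * (χ (size c ≡ᵇ a) * (q ^ size pat * q ^ newInversions c pat))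
      ≡⟨ cong (χ (allFilled pat c) *_) (x*[y*z]≡y*[x*z] (χ (size c ≡ᵇ a)) (q ^ size pat) _) ⟩
    χ (allFilled pat c) * (q ^ size pat * (χ (size c ≡ᵇ a) * q ^ newInversions c pat))
      ≡⟨ x*[y*z]≡y*[x*z] (χ (allFilled pat c)) (q ^ size pat) _ ⟩
    q ^ size pat * columnWeight q a pat c ∎)
  (sym (*-distribˡ-∑ (q ^ size pat) (allVec bits k) _))

-- stepCoeff q k a i = ∑ of extensionWeight q a pat over the patterns pat of k blocks
-- with i nonempty ones; the recursion is on the first block.
stepCoeff : ℕ → ℕ → ℕ → ℕ → ℕ
stepCoeff q zero    zero    zero    = 1
stepCoeff q zero    zero    (suc i) = 0
stepCoeff q zero    (suc a) i       = 0
stepCoeff q (suc k) zero    zero    = 0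
stepCoeff q (suc k) zero    (suc i) = stepCoeff q k zero i
stepCoeff q (suc k) (suc a) zero    = stepCoeff q k a zero
stepCoeff q (suc k) (suc a) (suc i) =
  stepCoeff q k a i * q ^ i + stepCoeff q k (suc a) i + stepCoeff q k a (suc i) * q ^ suc i

stepCoeff-k<i : ∀ q k a i → k < i → stepCoeff q k a i ≡ 0
stepCoeff-k<i q zero    zero    (suc i) _         = refl
stepCoeff-k<i q zero    (suc a) (suc i) _         = refl
stepCoeff-k<i q (suc k) zero    (suc i) (s≤s k<i) = stepCoeff-k<i q k zero i k<i
stepCoeff-k<i q (suc k) (suc a) (suc i) (s≤s k<i) =
  cong₂ _+_ (cong₂ _+_ (cong (_* q ^ i) (stepCoeff-k<i q k a i k<i)) (stepCoeff-k<i q k (suc a) i k<i))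
            (cong (_* q ^ suc i) (stepCoeff-k<i q k a (suc i) (m<n⇒m<1+n k<i)))

stepCoeff-a+i<k : ∀ q k a i → a + i < k → stepCoeff q k a i ≡ 0
stepCoeff-a+i<k q (suc k) zero    zero    _        = refl
stepCoeff-a+i<k q (suc k) zero    (suc i) (s≤s lt) = stepCoeff-a+i<k q k zero i lt
stepCoeff-a+i<k q (suc k) (suc a) zero    (s≤s lt) = stepCoeff-a+i<k q k a zero lt
stepCoeff-a+i<k q (suc k) (suc a) (suc i) (s≤s lt) =
  cong₂ _+_ (cong₂ _+_ (cong (_* q ^ i) (stepCoeff-a+i<k q k a i (≤-trans (n≤1+n _) lt′)))
                       (stepCoeff-a+i<k q k (suc a) i lt′))
            (cong (_* q ^ suc i) (stepCoeff-a+i<k q k a (suc i) lt))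
  where lt′ : suc a + i < k
        lt′ = subst (_< k) (+-suc a i) lt

stepCoeff-k<a : ∀ q k a i → k < a → stepCoeff q k a i ≡ 0
stepCoeff-k<a q zero    (suc a) i       _         = refl
stepCoeff-k<a q (suc k) (suc a) zero    (s≤s k<a) = stepCoeff-k<a q k a zero k<a
stepCoeff-k<a q (suc k) (suc a) (suc i) (s≤s k<a) =
  cong₂ _+_ (cong₂ _+_ (cong (_* q ^ i) (stepCoeff-k<a q k a i k<a)) (stepCoeff-k<a q k (suc a) i (m<n⇒m<1+n k<a)))
            (cong (_* q ^ suc i) (stepCoeff-k<a q k a (suc i) k<a))

patternSum : ℕ → ℕ → ℕ → (ℕ → ℕ) → ℕ
patternSum q a k M = ∑[ pat ∈ allVec bits k ] extensionWeight q a pat * M (size pat)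

patternSum-suc : ∀ q a k M → patternSum q a (suc k) M ≡
  (∑[ pat ∈ allVec bits k ] (headWeight q a pat + extensionWeight q a pat) * M (suc (size pat)))
  + (∑[ pat ∈ allVec bits k ] headWeight q a pat * M (size pat))
patternSum-suc q a k M = trans (∑-allVec-suc bits k _) (cong₂ _+_
  (∑-cong (allVec bits k) (λ pat → cong (_* M (suc (size pat))) (extensionWeight-true∷ q a pat)))
  (trans (+-identityʳ _) (∑-cong (allVec bits k) (λ pat → cong (_* M (size pat)) (extensionWeight-false∷ q a pat)))))

patternSum-suc-zero : ∀ q k M → patternSum q zero (suc k) M ≡ patternSum q zero k (M ∘ suc)
patternSum-suc-zero q k M = begin
  patternSum q zero (suc k) M
    ≡⟨ patternSum-suc q zero k M ⟩
  _ ≡⟨ cong₂ _+_ (∑-cong (allVec bits k) (λ pat →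
                   cong (λ h → (h + extensionWeight q zero pat) * M (suc (size pat))) (headWeight-zero q pat)))
                 (trans (∑-cong (allVec bits k) (λ pat → cong (_* M (size pat)) (headWeight-zero q pat))) (∑-zero (allVec bits k))) ⟩
  patternSum q zero k (M ∘ suc) + 0
    ≡⟨ +-identityʳ _ ⟩
  patternSum q zero k (M ∘ suc) ∎

patternSum-suc-suc : ∀ q a k M → patternSum q (suc a) (suc k) M ≡
  patternSum q a k (λ m → q ^ m * M (suc m)) + patternSum q (suc a) k (M ∘ suc) + patternSum q a k (λ m → q ^ m * M m)
patternSum-suc-suc q a k M = begin
  patternSum q (suc a) (suc k) M
    ≡⟨ patternSum-suc q (suc a) k M ⟩
  _ ≡⟨ cong₂ _+_ (trans (∑-cong (allVec bits k) split-first) (∑-distrib-+ (allVec bits k) _ _))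
                 (∑-cong (allVec bits k) (λ pat → trans (cong (_* M (size pat)) (headWeight-suc q a pat))
                                                        (regroup (q ^ size pat) (extensionWeight q a pat) (M (size pat))))) ⟩
  patternSum q a k (λ m → q ^ m * M (suc m)) + patternSum q (suc a) k (M ∘ suc) + patternSum q a k (λ m → q ^ m * M m) ∎
  where
  regroup : ∀ x y z → x * y * z ≡ y * (x * z)
  regroup x y z = trans (cong (_* z) (*-comm x y)) (*-assoc y x z)
  split-first : ∀ pat → (headWeight q (suc a) pat + extensionWeight q (suc a) pat) * M (suc (size pat))
                      ≡ extensionWeight q a pat * (q ^ size pat * M (suc (size pat))) + extensionWeight q (suc a) pat * M (suc (size pat))
  split-first pat = trans (cong (λ h → (h + extensionWeight q (suc a) pat) * M (suc (size pat))) (headWeight-suc q a pat))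
                          (trans (*-distribʳ-+ (M (suc (size pat))) (q ^ size pat * extensionWeight q a pat) (extensionWeight q (suc a) pat))
                                 (cong (_+ extensionWeight q (suc a) pat * M (suc (size pat)))
                                       (regroup (q ^ size pat) (extensionWeight q a pat) (M (suc (size pat))))))

patternSum≡∑<stepCoeff : ∀ q a k M → patternSum q a k M ≡ (∑[ i < suc k ] stepCoeff q k a i * M i)
patternSum≡∑<stepCoeff q zero    zero    M = refl
patternSum≡∑<stepCoeff q (suc a) zero    M = refl
patternSum≡∑<stepCoeff q zero    (suc k) M =
  trans (patternSum-suc-zero q k M) (patternSum≡∑<stepCoeff q zero k (M ∘ suc))
patternSum≡∑<stepCoeff q (suc a) (suc k) M = begin
  patternSum q (suc a) (suc k) M
    ≡⟨ patternSum-suc-suc q a k M ⟩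
  patternSum q a k (λ m → q ^ m * M (suc m)) + patternSum q (suc a) k (M ∘ suc) + patternSum q a k (λ m → q ^ m * M m)
    ≡⟨ cong₂ _+_ (cong₂ _+_ (patternSum≡∑<stepCoeff q a k (λ m → q ^ m * M (suc m))) (patternSum≡∑<stepCoeff q (suc a) k (M ∘ suc)))
                 (trans (patternSum≡∑<stepCoeff q a k (λ m → q ^ m * M m))
                        (∑<-shift k (λ i → stepCoeff q k a i * (q ^ i * M i))
                                  (cong (_* (q ^ suc k * M (suc k))) (stepCoeff-k<i q k a (suc k) ≤-refl)))) ⟩
  ∑< (suc k) f₁ + ∑< (suc k) f₂ + (stepCoeff q k a 0 * (1 * M 0) + ∑< (suc k) f₃)
    ≡⟨ +-comm (∑< (suc k) f₁ + ∑< (suc k) f₂) _ ⟩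
  stepCoeff q k a 0 * (1 * M 0) + ∑< (suc k) f₃ + (∑< (suc k) f₁ + ∑< (suc k) f₂)
    ≡⟨ +-assoc (stepCoeff q k a 0 * (1 * M 0)) _ _ ⟩
  stepCoeff q k a 0 * (1 * M 0) + (∑< (suc k) f₃ + (∑< (suc k) f₁ + ∑< (suc k) f₂))
    ≡⟨ cong₂ _+_ (cong (stepCoeff q k a 0 *_) (*-identityˡ (M 0)))
                 (trans (cong (∑< (suc k) f₃ +_) (sym (∑<-distrib-+ (suc k) f₁ f₂)))
                        (sym (∑<-distrib-+ (suc k) f₃ (λ i → f₁ i + f₂ i)))) ⟩
  stepCoeff q k a 0 * M 0 + (∑[ i < suc k ] f₃ i + (f₁ i + f₂ i))
    ≡⟨ cong (stepCoeff q k a 0 * M 0 +_) (∑<-cong (suc k) (λ i _ →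
         collect (stepCoeff q k a i) (q ^ i) (stepCoeff q k (suc a) i) (stepCoeff q k a (suc i)) (q ^ suc i) (M (suc i)))) ⟩
  (∑[ i < suc (suc k) ] stepCoeff q (suc k) (suc a) i * M i) ∎
  where
  f₁ f₂ f₃ : ℕ → ℕ
  f₁ i = stepCoeff q k a i * (q ^ i * M (suc i))
  f₂ i = stepCoeff q k (suc a) i * M (suc i)
  f₃ i = stepCoeff q k a (suc i) * (q ^ suc i * M (suc i))
  collect : ∀ c x d e y m → e * (y * m) + (c * (x * m) + d * m) ≡ (c * x + d + e * y) * m
  collect = solve-∀

-- Gaussian binomial coefficients

qbin : ℕ → ℕ → ℕ → ℕ
qbin q zero    zero    = 1
qbin q zero    (suc k) = 0
qbin q (suc n) zero    = 1
qbin q (suc n) (suc k) = qbin q n k + q ^ suc k * qbin q n (suc k)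

qbin-zeroʳ : ∀ q n → qbin q n 0 ≡ 1
qbin-zeroʳ q zero    = refl
qbin-zeroʳ q (suc n) = refl

qbin-< : ∀ q n k → n < k → qbin q n k ≡ 0
qbin-< q zero    (suc k) _         = refl
qbin-< q (suc n) (suc k) (s≤s n<k) =
  trans (cong₂ _+_ (qbin-< q n k n<k) (cong (q ^ suc k *_) (qbin-< q n (suc k) (m<n⇒m<1+n n<k)))) (*-zeroʳ (q ^ suc k))

qbin-diag : ∀ q n → qbin q n n ≡ 1
qbin-diag q zero    = refl
qbin-diag q (suc n) =
  trans (cong₂ _+_ (qbin-diag q n) (cong (q ^ suc n *_) (qbin-< q n (suc n) ≤-refl))) (cong suc (*-zeroʳ (q ^ suc n)))

qint-+ : ∀ q m p → qint q (m + p) ≡ qint q m + q ^ m * qint q p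
qint-+ q zero    p = sym (+-identityʳ (qint q p))
qint-+ q (suc m) p = begin
  1 + q * qint q (m + p)                      ≡⟨ cong (λ z → 1 + q * z) (qint-+ q m p) ⟩
  1 + q * (qint q m + q ^ m * qint q p)       ≡⟨ cong suc (*-distribˡ-+ q (qint q m) _) ⟩
  1 + (q * qint q m + q * (q ^ m * qint q p)) ≡⟨ cong (λ t → 1 + (q * qint q m + t)) (sym (*-assoc q (q ^ m) _)) ⟩
  qint q (suc m) + q ^ suc m * qint q p       ∎

qbin-qfact : ∀ q n k d → k + d ≡ n → qbin q n k * (qfact q k * qfact q d) ≡ qfact q n
qbin-qfact q n zero d refl = trans (cong (_* (1 * qfact q d)) (qbin-zeroʳ q d)) (trans (*-identityˡ _) (*-identityˡ _))
qbin-qfact q (suc n) (suc k) zero eq with trans (sym (+-identityʳ k)) (suc-injective eq)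
... | refl = trans (cong (_* (qfact q (suc k) * 1)) (qbin-diag q (suc k))) (trans (*-identityˡ _) (*-identityʳ _))
qbin-qfact q (suc n) (suc k) (suc d) eq = begin
  (qbin q n k + q ^ suc k * qbin q n (suc k)) * ((qint q (suc k) * qfact q k) * (qint q (suc d) * qfact q d))
    ≡⟨ distribute (qbin q n k) (q ^ suc k) (qbin q n (suc k)) (qint q (suc k)) (qfact q k) (qint q (suc d)) (qfact q d) ⟩
  qint q (suc k) * (qbin q n k * (qfact q k * qfact q (suc d)))
    + (q ^ suc k * qint q (suc d)) * (qbin q n (suc k) * (qfact q (suc k) * qfact q d))
    ≡⟨ cong₂ _+_ (cong (qint q (suc k) *_) (qbin-qfact q n k (suc d) k+1+d≡n))
                 (cong (q ^ suc k * qint q (suc d) *_) (qbin-qfact q n (suc k) d (trans (sym (+-suc k d)) k+1+d≡n))) ⟩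
  qint q (suc k) * qfact q n + (q ^ suc k * qint q (suc d)) * qfact q n
    ≡⟨ sym (*-distribʳ-+ (qfact q n) (qint q (suc k)) _) ⟩
  (qint q (suc k) + q ^ suc k * qint q (suc d)) * qfact q n
    ≡⟨ cong (_* qfact q n) (sym (trans (cong (qint q) (sym eq)) (qint-+ q (suc k) (suc d)))) ⟩
  qfact q (suc n) ∎
  where
  k+1+d≡n : k + suc d ≡ n
  k+1+d≡n = suc-injective eq
  distribute : ∀ g₁ Q g₂ A F B D → (g₁ + Q * g₂) * ((A * F) * (B * D))
               ≡ A * (g₁ * (F * (B * D))) + (Q * B) * (g₂ * ((A * F) * D))
  distribute = solve-∀

qfact*qfact≢0 : ∀ q m p → NonZero (qfact q m * qfact q p)
qfact*qfact≢0 q m p = m*n≢0 (qfact q m) (qfact q p) {{qfact-nz q m}} {{qfact-nz q p}}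

qbin-pascalʳ : ∀ q k f → qbin q (suc (k + f)) (suc k) ≡ q ^ f * qbin q (k + f) k + qbin q (k + f) (suc k)
qbin-pascalʳ q k f = *-cancelʳ-≡ _ _ (qfact q (suc k) * qfact q f) {{qfact*qfact≢0 q (suc k) f}} (begin
  qbin q (suc (k + f)) (suc k) * (qfact q (suc k) * qfact q f)
    ≡⟨ qbin-qfact q (suc (k + f)) (suc k) f refl ⟩
  qint q (suc (k + f)) * qfact q (k + f)
    ≡⟨ cong (λ z → qint q z * qfact q (k + f)) (trans (cong suc (+-comm k f)) (sym (+-suc f k))) ⟩
  qint q (f + suc k) * qfact q (k + f)
    ≡⟨ cong (_* qfact q (k + f)) (qint-+ q f (suc k)) ⟩
  (qint q f + q ^ f * qint q (suc k)) * qfact q (k + f)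
    ≡⟨ trans (*-distribʳ-+ (qfact q (k + f)) (qint q f) _) (+-comm (qint q f * qfact q (k + f)) _) ⟩
  q ^ f * qint q (suc k) * qfact q (k + f) + qint q f * qfact q (k + f)
    ≡⟨ cong₂ _+_ (cong (q ^ f * qint q (suc k) *_) (sym (qbin-qfact q (k + f) k f refl))) (sym (upper f)) ⟩
  q ^ f * qint q (suc k) * (qbin q (k + f) k * (qfact q k * qfact q f)) + qbin q (k + f) (suc k) * (qfact q (suc k) * qfact q f)
    ≡⟨ factor (q ^ f) (qint q (suc k)) (qbin q (k + f) k) (qfact q k) (qfact q f) (qbin q (k + f) (suc k)) ⟩
  (q ^ f * qbin q (k + f) k + qbin q (k + f) (suc k)) * (qfact q (suc k) * qfact q f) ∎)
  where
  factor : ∀ Q A g F D g′ → Q * A * (g * (F * D)) + g′ * ((A * F) * D) ≡ (Q * g + g′) * ((A * F) * D)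
  factor = solve-∀
  upper : ∀ f → qbin q (k + f) (suc k) * (qfact q (suc k) * qfact q f) ≡ qint q f * qfact q (k + f)
  upper zero    = cong (_* (qfact q (suc k) * 1)) (qbin-< q (k + 0) (suc k) (s≤s (≤-reflexive (+-identityʳ k))))
  upper (suc f) = begin
    qbin q (k + suc f) (suc k) * (qfact q (suc k) * (qint q (suc f) * qfact q f))
      ≡⟨ cong (qbin q (k + suc f) (suc k) *_) (x*[y*z]≡y*[x*z] (qfact q (suc k)) (qint q (suc f)) _) ⟩
    qbin q (k + suc f) (suc k) * (qint q (suc f) * (qfact q (suc k) * qfact q f))
      ≡⟨ x*[y*z]≡y*[x*z] (qbin q (k + suc f) (suc k)) (qint q (suc f)) _ ⟩
    qint q (suc f) * (qbin q (k + suc f) (suc k) * (qfact q (suc k) * qfact q f))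
      ≡⟨ cong (qint q (suc f) *_) (qbin-qfact q (k + suc f) (suc k) f (sym (+-suc k f))) ⟩
    qint q (suc f) * qfact q (k + suc f) ∎

-- Closed form of stepCoeff, with k = e + f + t blocks, a = e + t copies of the new value
-- and i = e + f previously nonempty blocks: e of them receive the new value, f do not,
-- and the t previously empty blocks must all receive it.

closedCoeff : ℕ → ℕ → ℕ → ℕ → ℕ
closedCoeff q e f t = q ^ (e C 2) * qbin q (e + f) e * qbin q (e + f + t) (e + f)

qbin-+0-diag : ∀ q n → qbin q (n + 0) n ≡ 1
qbin-+0-diag q n rewrite +-identityʳ n = qbin-diag q n

stepCoeff-fill : ∀ q f t → stepCoeff q (f + t) t f ≡ qbin q (f + t) f
stepCoeff-fill q zero    zero    = refl
stepCoeff-fill q (suc f) zero    = trans (stepCoeff-fill q f zero) (trans (qbin-+0-diag q f) (sym (qbin-+0-diag q (suc f))))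
stepCoeff-fill q zero    (suc t) = trans (stepCoeff-fill q zero t) (qbin-zeroʳ q t)
stepCoeff-fill q (suc f) (suc t) = begin
  stepCoeff q (f + suc t) t f * q ^ f + stepCoeff q (f + suc t) (suc t) f + stepCoeff q (f + suc t) t (suc f) * q ^ suc f
    ≡⟨ cong₂ _+_ (cong₂ _+_ (cong (_* q ^ f) (stepCoeff-a+i<k q (f + suc t) t f t+f<f+1+t)) (stepCoeff-fill q f (suc t)))
                 (cong (_* q ^ suc f) (trans (cong (λ k → stepCoeff q k t (suc f)) (+-suc f t))
                                             (trans (stepCoeff-fill q (suc f) t) (cong (λ n → qbin q n (suc f)) (sym (+-suc f t)))))) ⟩
  0 * q ^ f + qbin q (f + suc t) f + qbin q (f + suc t) (suc f) * q ^ suc f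
    ≡⟨ cong (qbin q (f + suc t) f +_) (*-comm (qbin q (f + suc t) (suc f)) (q ^ suc f)) ⟩
  qbin q (suc f + suc t) (suc f) ∎
  where
  t+f<f+1+t : t + f < f + suc t
  t+f<f+1+t = ≤-reflexive (trans (cong suc (+-comm t f)) (sym (+-suc f t)))

C2-suc : ∀ e → suc e C 2 ≡ e + e C 2
C2-suc e = trans (sym (nCk+nC[k+1]≡[n+1]C[k+1] e 1)) (cong (_+ e C 2) (nC1≡n e))

q^C2*q^[e+f] : ∀ q e f → q ^ (e C 2) * q ^ (e + f) ≡ q ^ (suc e C 2) * q ^ f
q^C2*q^[e+f] q e f = begin
  q ^ (e C 2) * q ^ (e + f)       ≡⟨ sym (^-distribˡ-+-* q (e C 2) (e + f)) ⟩
  q ^ (e C 2 + (e + f))           ≡⟨ cong (q ^_) (trans (sym (+-assoc (e C 2) e f)) (cong (_+ f) (+-comm (e C 2) e))) ⟩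
  q ^ (e + e C 2 + f)             ≡⟨ cong (λ x → q ^ (x + f)) (sym (C2-suc e)) ⟩
  q ^ (suc e C 2 + f)             ≡⟨ ^-distribˡ-+-* q (suc e C 2) f ⟩
  q ^ (suc e C 2) * q ^ f         ∎

stepCoeff-closed : ∀ q e f t → stepCoeff q (e + f + t) (e + t) (e + f) ≡ closedCoeff q e f t
stepCoeff-closed q zero    f t = trans (stepCoeff-fill q f t)
  (sym (trans (cong (_* qbin q (f + t) f) (trans (*-identityˡ _) (qbin-zeroʳ q f))) (*-identityˡ _)))
stepCoeff-closed q (suc e) f t = begin
  stepCoeff q (e + f + t) (e + t) (e + f) * q ^ (e + f) + stepCoeff q (e + f + t) (suc (e + t)) (e + f)
    + stepCoeff q (e + f + t) (e + t) (suc (e + f)) * q ^ suc (e + f)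
    ≡⟨ cong₂ _+_ (cong₂ _+_ (cong (_* q ^ (e + f)) (stepCoeff-closed q e f t)) (first-block-skipped f))
                 (cong (_* q ^ suc (e + f)) (first-block-new t)) ⟩
  q ^ (e C 2) * b * g * q ^ (e + f) + s₊ * b′ * g + s₊ * g₊ * g′ * q ^ suc (e + f)
    ≡⟨ cong (λ x → x + s₊ * b′ * g + s₊ * g₊ * g′ * q ^ suc (e + f))
            (trans (move-power (q ^ (e C 2)) b g (q ^ (e + f))) (cong (λ x → x * b * g) (q^C2*q^[e+f] q e f))) ⟩
  s₊ * q ^ f * b * g + s₊ * b′ * g + s₊ * g₊ * g′ * q ^ suc (e + f)
    ≡⟨ regroup s₊ (q ^ f) b g b′ g₊ g′ (q ^ suc (e + f)) ⟩
  s₊ * (q ^ f * b + b′) * g + s₊ * g₊ * (q ^ suc (e + f) * g′)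
    ≡⟨ cong (λ x → s₊ * x * g + s₊ * g₊ * (q ^ suc (e + f) * g′)) (sym (qbin-pascalʳ q e f)) ⟩
  s₊ * g₊ * g + s₊ * g₊ * (q ^ suc (e + f) * g′)
    ≡⟨ sym (*-distribˡ-+ (s₊ * g₊) g _) ⟩
  closedCoeff q (suc e) f t ∎
  where
  s₊ = q ^ (suc e C 2)
  b  = qbin q (e + f) e
  b′ = qbin q (e + f) (suc e)
  g  = qbin q (e + f + t) (e + f)
  g′ = qbin q (e + f + t) (suc (e + f))
  g₊ = qbin q (suc (e + f)) (suc e)
  move-power : ∀ p b g x → p * b * g * x ≡ p * x * b * g
  move-power = solve-∀
  regroup : ∀ s x b g b′ gs g′ y → s * x * b * g + s * b′ * g + s * gs * g′ * y ≡ s * (x * b + b′) * g + s * gs * (y * g′)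
  regroup = solve-∀
  first-block-skipped : ∀ f → stepCoeff q (e + f + t) (suc (e + t)) (e + f) ≡ s₊ * qbin q (e + f) (suc e) * qbin q (e + f + t) (e + f)
  first-block-skipped zero =
    trans (stepCoeff-k<a q (e + 0 + t) (suc (e + t)) (e + 0) (s≤s (≤-reflexive (cong (_+ t) (+-identityʳ e)))))
          (sym (trans (cong (λ b → s₊ * b * qbin q (e + 0 + t) (e + 0)) (qbin-< q (e + 0) (suc e) (s≤s (≤-reflexive (+-identityʳ e)))))
                      (cong (_* qbin q (e + 0 + t) (e + 0)) (*-zeroʳ s₊))))
  first-block-skipped (suc f) rewrite +-suc e f = stepCoeff-closed q (suc e) f t
  first-block-new : ∀ t → stepCoeff q (e + f + t) (e + t) (suc (e + f)) ≡ s₊ * g₊ * qbin q (e + f + t) (suc (e + f))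
  first-block-new zero =
    trans (stepCoeff-k<i q (e + f + 0) (e + 0) (suc (e + f)) (s≤s (≤-reflexive (+-identityʳ (e + f)))))
          (sym (trans (cong (s₊ * g₊ *_) (qbin-< q (e + f + 0) (suc (e + f)) (s≤s (≤-reflexive (+-identityʳ (e + f))))))
                      (*-zeroʳ (s₊ * g₊))))
  first-block-new (suc t) rewrite +-suc (e + f) t | +-suc e t = stepCoeff-closed q (suc e) f t

Scoeff : ℕ → ℕ → ℕ → ℕ → ℕ
Scoeff q a k i = if (a + i) <ᵇ k then 0
  else q ^ ((a + i ∸ k) C 2) * qbinom q i (a + i ∸ k) * qfactQuot q a (k ∸ i)

Sterm≡Scoeff* : ∀ q a k (Sprev : ℕ → ℕ) i → Sterm q a k Sprev i ≡ Scoeff q a k i * Sprev i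
Sterm≡Scoeff* q a k Sprev i with (a + i) <ᵇ k
... | true  = refl
... | false = refl

if-true : ∀ {b} {x y : ℕ} → T b → (if b then x else y) ≡ x
if-true {true} _ = refl

if-false : ∀ {b} {x y : ℕ} → ¬ T b → (if b then x else y) ≡ y
if-false {true}  ¬b = contradiction tt ¬b
if-false {false} _  = refl

/-exact : ∀ m n x .{{_ : NonZero n}} → m ≡ x * n → m / n ≡ x
/-exact m n x m≡x*n = trans (cong (_/ n) m≡x*n) (m*n/n≡m x n)

qbinom-< : ∀ q m j → m < j → qbinom q m j ≡ 0
qbinom-< q m j m<j = if-true (<⇒<ᵇ m<j)

qbinom≡qbin : ∀ q e f → qbinom q (e + f) e ≡ qbin q (e + f) e
qbinom≡qbin q e f = trans (if-false (λ lt → <⇒≱ (<ᵇ⇒< (e + f) e lt) (m≤m+n e f)))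
  (/-exact _ _ _ {{qfact*qfact≢0 q e (e + f ∸ e)}}
    (sym (subst (λ d → qbin q (e + f) e * (qfact q e * qfact q d) ≡ qfact q (e + f)) (sym (m+n∸m≡n e f))
                (qbin-qfact q (e + f) e f refl))))

qfactQuot≡qbin*qfact : ∀ q e t → qfactQuot q (e + t) t ≡ qbin q (e + t) t * qfact q e
qfactQuot≡qbin*qfact q e t = /-exact _ _ _ {{qfact-nz q t}}
  (trans (sym (qbin-qfact q (e + t) t e (+-comm t e))) (x*[y*z]≡xz*y (qbin q (e + t) t) (qfact q t) (qfact q e)))

Scoeff-closed : ∀ q e f t → Scoeff q (e + t) (e + f + t) (e + f) ≡ q ^ (e C 2) * qbin q (e + f) e * (qbin q (e + t) t * qfact q e)
Scoeff-closed q e f t = begin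
  Scoeff q (e + t) (e + f + t) (e + f)
    ≡⟨ if-false (λ lt → <⇒≱ (<ᵇ⇒< (e + t + (e + f)) _ lt)
                            (≤-trans (m≤m+n (e + f + t) e) (≤-reflexive (sym e+t+[e+f]≡e+f+t+e)))) ⟩
  q ^ ((e + t + (e + f) ∸ (e + f + t)) C 2) * qbinom q (e + f) (e + t + (e + f) ∸ (e + f + t)) * qfactQuot q (e + t) (e + f + t ∸ (e + f))
    ≡⟨ cong₂ (λ x y → q ^ (x C 2) * qbinom q (e + f) x * qfactQuot q (e + t) y) e+t+[e+f]∸[e+f+t]≡e (m+n∸m≡n (e + f) t) ⟩
  q ^ (e C 2) * qbinom q (e + f) e * qfactQuot q (e + t) t
    ≡⟨ cong₂ (λ x y → q ^ (e C 2) * x * y) (qbinom≡qbin q e f) (qfactQuot≡qbin*qfact q e t) ⟩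
  q ^ (e C 2) * qbin q (e + f) e * (qbin q (e + t) t * qfact q e) ∎
  where
  e+t+[e+f]≡e+f+t+e : e + t + (e + f) ≡ e + f + t + e
  e+t+[e+f]≡e+f+t+e = permute e f t
    where permute : ∀ e f t → e + t + (e + f) ≡ e + f + t + e
          permute = solve-∀
  e+t+[e+f]∸[e+f+t]≡e : e + t + (e + f) ∸ (e + f + t) ≡ e
  e+t+[e+f]∸[e+f+t]≡e = trans (cong (_∸ (e + f + t)) e+t+[e+f]≡e+f+t+e) (m+n∸m≡n (e + f + t) e)

stepCoeff-qfact-closed : ∀ q e f t → stepCoeff q (e + f + t) (e + t) (e + f) * qfact q (e + t) * qfact q (e + f)
                                     ≡ qfact q (e + f + t) * Scoeff q (e + t) (e + f + t) (e + f)
stepCoeff-qfact-closed q e f t rewrite stepCoeff-closed q e f t =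
  *-cancelʳ-≡ _ _ (qfact q t) {{qfact-nz q t}} (begin
    p * b * g * qfact q (e + t) * qfact q (e + f) * qfact q t
      ≡⟨ collect p b g (qfact q (e + t)) (qfact q (e + f)) (qfact q t) ⟩
    p * b * qfact q (e + t) * (g * (qfact q (e + f) * qfact q t))
      ≡⟨ cong (p * b * qfact q (e + t) *_) (qbin-qfact q (e + f + t) (e + f) t refl) ⟩
    p * b * qfact q (e + t) * qfact q (e + f + t)
      ≡⟨ cong (λ x → p * b * x * qfact q (e + f + t)) (sym (qbin-qfact q (e + t) t e (+-comm t e))) ⟩
    p * b * (qbin q (e + t) t * (qfact q t * qfact q e)) * qfact q (e + f + t)
      ≡⟨ uncollect p b (qbin q (e + t) t) (qfact q t) (qfact q e) (qfact q (e + f + t)) ⟩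
    qfact q (e + f + t) * (p * b * (qbin q (e + t) t * qfact q e)) * qfact q t
      ≡⟨ cong (λ x → qfact q (e + f + t) * x * qfact q t) (sym (Scoeff-closed q e f t)) ⟩
    qfact q (e + f + t) * Scoeff q (e + t) (e + f + t) (e + f) * qfact q t ∎)
  where
  p = q ^ (e C 2)
  b = qbin q (e + f) e
  g = qbin q (e + f + t) (e + f)
  collect : ∀ p b g x y z → p * b * g * x * y * z ≡ p * b * x * (g * (y * z))
  collect = solve-∀
  uncollect : ∀ p b c x y z → p * b * (c * (x * y)) * z ≡ z * (p * b * (c * y)) * x
  uncollect = solve-∀

block-decomposition : ∀ {k a i} → i ≤ k → a ≤ k → k ≤ a + i →
                      ∃ λ e → ∃ λ f → ∃ λ t → k ≡ e + f + t × a ≡ e + t × i ≡ e + f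
block-decomposition {k} {a} {i} i≤k a≤k k≤a+i
  with m≤n⇒∃[o]m+o≡n k≤a+i | m≤n⇒∃[o]m+o≡n a≤k | m≤n⇒∃[o]m+o≡n i≤k
... | e , k+e≡a+i | f , a+f≡k | t , i+t≡k = e , f , t , trans (sym i+t≡k) (cong (_+ t) i≡e+f) , a≡e+t , i≡e+f
  where
  i≡e+f : i ≡ e + f
  i≡e+f = trans (sym (+-cancelˡ-≡ a (f + e) i (trans (sym (+-assoc a f e)) (trans (cong (_+ e) a+f≡k) k+e≡a+i))))
                (+-comm f e)
  a≡e+t : a ≡ e + t
  a≡e+t = trans (+-cancelʳ-≡ i a (t + e) (trans (sym k+e≡a+i) (trans (cong (_+ e) (sym i+t≡k)) (rotate i t e))))
                (+-comm t e)
    where rotate : ∀ i t e → i + t + e ≡ t + e + i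
          rotate = solve-∀

stepCoeff-qfact : ∀ q a k i → i ≤ k → stepCoeff q k a i * qfact q a * qfact q i ≡ qfact q k * Scoeff q a k i
stepCoeff-qfact q a k i i≤k with a + i <? k
... | yes a+i<k = begin
  stepCoeff q k a i * qfact q a * qfact q i ≡⟨ cong (λ c → c * qfact q a * qfact q i) (stepCoeff-a+i<k q k a i a+i<k) ⟩
  0                                         ≡⟨ sym (*-zeroʳ (qfact q k)) ⟩
  qfact q k * 0                             ≡⟨ cong (qfact q k *_) (sym (if-true (<⇒<ᵇ a+i<k))) ⟩
  qfact q k * Scoeff q a k i                ∎
... | no a+i≮k with a ≤? k
...   | no a≰k = begin
  stepCoeff q k a i * qfact q a * qfact q i ≡⟨ cong (λ c → c * qfact q a * qfact q i) (stepCoeff-k<a q k a i (≰⇒> a≰k)) ⟩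
  0                                         ≡⟨ sym (*-zeroʳ (qfact q k)) ⟩
  qfact q k * 0                             ≡⟨ cong (qfact q k *_) (sym Scoeff≡0) ⟩
  qfact q k * Scoeff q a k i                ∎
  where
  i<a+i∸k : i < a + i ∸ k
  i<a+i∸k = subst (i <_) (sym (+-∸-comm i (<⇒≤ (≰⇒> a≰k)))) (m<n+m i (m<n⇒0<n∸m (≰⇒> a≰k)))
  Scoeff≡0 : Scoeff q a k i ≡ 0
  Scoeff≡0 = begin
    Scoeff q a k i
      ≡⟨ if-false (a+i≮k ∘ <ᵇ⇒< (a + i) k) ⟩
    q ^ ((a + i ∸ k) C 2) * qbinom q i (a + i ∸ k) * qfactQuot q a (k ∸ i)
      ≡⟨ cong (λ x → q ^ ((a + i ∸ k) C 2) * x * qfactQuot q a (k ∸ i)) (qbinom-< q i (a + i ∸ k) i<a+i∸k) ⟩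
    q ^ ((a + i ∸ k) C 2) * 0 * qfactQuot q a (k ∸ i)
      ≡⟨ cong (_* qfactQuot q a (k ∸ i)) (*-zeroʳ (q ^ ((a + i ∸ k) C 2))) ⟩
    0 ∎
...   | yes a≤k with block-decomposition i≤k a≤k (≮⇒≥ a+i≮k)
...     | e , f , t , refl , refl , refl = stepCoeff-qfact-closed q e f t

stepCoeff-Sterm : ∀ q a k i (Sprev : ℕ → ℕ) → i ≤ k →
                  stepCoeff q k a i * qfact q a * (qfact q i * Sprev i) ≡ qfact q k * Sterm q a k Sprev i
stepCoeff-Sterm q a k i Sprev i≤k = begin
  stepCoeff q k a i * qfact q a * (qfact q i * Sprev i) ≡⟨ sym (*-assoc (stepCoeff q k a i * qfact q a) _ _) ⟩
  stepCoeff q k a i * qfact q a * qfact q i * Sprev i   ≡⟨ cong (_* Sprev i) (stepCoeff-qfact q a k i i≤k) ⟩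
  qfact q k * Scoeff q a k i * Sprev i                  ≡⟨ *-assoc (qfact q k) _ _ ⟩
  qfact q k * (Scoeff q a k i * Sprev i)                ≡⟨ cong (qfact q k *_) (sym (Sterm≡Scoeff* q a k Sprev i)) ⟩
  qfact q k * Sterm q a k Sprev i                       ∎

MahRows-∑<stepCoeff : ∀ q a n k → MahRows q a (suc n) k ≡ (∑[ i < suc k ] stepCoeff q k a i * MahRows q a n i)
MahRows-∑<stepCoeff q a n k = trans (MahRows-recursion q a n k) (patternSum≡∑<stepCoeff q a k (MahRows q a n))

stepCoeff-zeroʳ : ∀ q k a → stepCoeff q k a 0 ≡ χ (k ≡ᵇ a)
stepCoeff-zeroʳ q zero    zero    = refl
stepCoeff-zeroʳ q zero    (suc a) = refl
stepCoeff-zeroʳ q (suc k) zero    = refl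
stepCoeff-zeroʳ q (suc k) (suc a) = stepCoeff-zeroʳ q k a

MahRows-zero-suc : ∀ q a i → MahRows q a 0 (suc i) ≡ 0
MahRows-zero-suc q a i = trans (∑-allVec-suc (subsets 0) i _) (trans (+-identityʳ _) (∑-zero (allVec (subsets 0) i)))

MahRows-one : ∀ q a k → MahRows q a 1 k ≡ χ (k ≡ᵇ a)
MahRows-one q a k = begin
  MahRows q a 1 k
    ≡⟨ MahRows-∑<stepCoeff q a 0 k ⟩
  stepCoeff q k a 0 * 1 + (∑[ i < k ] stepCoeff q k a (suc i) * MahRows q a 0 (suc i))
    ≡⟨ cong₂ _+_ (trans (*-identityʳ _) (stepCoeff-zeroʳ q k a))
                 (trans (∑<-cong k (λ i _ → trans (cong (stepCoeff q k a (suc i) *_) (MahRows-zero-suc q a i))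
                                                  (*-zeroʳ (stepCoeff q k a (suc i)))))
                        (∑<-zero k)) ⟩
  χ (k ≡ᵇ a) + 0
    ≡⟨ +-identityʳ _ ⟩
  χ (k ≡ᵇ a) ∎

S-zero : ∀ q a m → 1 ≤ a → S q a (suc m) 0 ≡ 0
S-zero q (suc a) zero    _ = refl
S-zero q (suc a) (suc m) _ = refl

χ-≡ᵇ-* : ∀ (f : ℕ → ℕ) k a → χ (k ≡ᵇ a) * f a ≡ f k * χ (k ≡ᵇ a)
χ-≡ᵇ-* f k a with k ≡ᵇ a in k≡ᵇa
... | true  rewrite ≡ᵇ⇒≡ k a (subst T (sym k≡ᵇa) tt) = trans (+-identityʳ (f a)) (sym (*-identityʳ (f a)))
... | false = sym (*-zeroʳ (f k))

MahRows-qfact : ∀ q a → 1 ≤ a → ∀ m k → MahRows q a (suc m) k * qfact q a ^ suc m ≡ qfact q k * S q a (suc m) k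
MahRows-qfact q a 1≤a zero k = begin
  MahRows q a 1 k * (qfact q a * 1)  ≡⟨ cong₂ _*_ (MahRows-one q a k) (*-identityʳ (qfact q a)) ⟩
  χ (k ≡ᵇ a) * qfact q a             ≡⟨ χ-≡ᵇ-* (qfact q) k a ⟩
  qfact q k * χ (k ≡ᵇ a)             ∎
MahRows-qfact q a 1≤a (suc m) k = begin
  MahRows q a (suc (suc m)) k * (qfact q a * qfact q a ^ suc m)
    ≡⟨ cong (_* (qfact q a * qfact q a ^ suc m)) (MahRows-∑<stepCoeff q a (suc m) k) ⟩
  (∑[ i < suc k ] stepCoeff q k a i * MahRows q a (suc m) i) * (qfact q a * qfact q a ^ suc m)
    ≡⟨ *-distribʳ-∑< (suc k) (qfact q a * qfact q a ^ suc m) (λ i → stepCoeff q k a i * MahRows q a (suc m) i) ⟩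
  (∑[ i < suc k ] stepCoeff q k a i * MahRows q a (suc m) i * (qfact q a * qfact q a ^ suc m))
    ≡⟨ ∑<-cong (suc k) (λ i _ → trans (regroup (stepCoeff q k a i) (MahRows q a (suc m) i) (qfact q a) (qfact q a ^ suc m))
                                      (cong (stepCoeff q k a i * qfact q a *_) (MahRows-qfact q a 1≤a m i))) ⟩
  (∑[ i < suc k ] stepCoeff q k a i * qfact q a * (qfact q i * S q a (suc m) i))
    ≡⟨ cong₂ _+_ (trans (cong (λ s → stepCoeff q k a 0 * qfact q a * (1 * s)) (S-zero q a m 1≤a))
                        (*-zeroʳ (stepCoeff q k a 0 * qfact q a)))
                 (∑<-cong k (λ j j<k → stepCoeff-Sterm q a k (suc j) (S q a (suc m)) j<k)) ⟩
  0 + (∑[ j < k ] qfact q k * Sterm q a k (S q a (suc m)) (suc j))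
    ≡⟨ sym (*-distribˡ-∑< k (qfact q k) (Sterm q a k (S q a (suc m)) ∘ suc)) ⟩
  qfact q k * (∑[ j < k ] Sterm q a k (S q a (suc m)) (suc j))
    ≡⟨ cong (qfact q k *_) (sym (sum-map-applyUpTo≡∑< (Sterm q a k (S q a (suc m)) ∘ suc) (λ i → i) k)) ⟩
  qfact q k * S q a (suc (suc m)) k ∎
  where
  regroup : ∀ c x f p → c * x * (f * p) ≡ c * f * (x * p)
  regroup = solve-∀

Mah-qfact : ∀ q a n → 1 ≤ a → 1 ≤ n → ∀ k → Mah q a n k * qfact q a ^ n ≡ qfact q k * S q a n k
Mah-qfact q a (suc m) 1≤a _ k = trans (cong (_* qfact q a ^ suc m) (Mah≡MahRows q a (suc m) k)) (MahRows-qfact q a 1≤a m k)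

qfact-one : ∀ q → qfact q 1 ≡ 1
qfact-one q = trans (*-identityʳ _) (cong suc (*-zeroʳ q))

proposition3p8 : ((a n k : ℕ) → 1 ≤ a → 1 ≤ n → 1 ≤ k → (q : ℕ) →
    Mah q a n k * (qfact q a ^ n) ≡ qfact q k * S q a n k)
    ×
    ((n k : ℕ) → 1 ≤ n → 1 ≤ k → (q : ℕ) →
    Mah q 1 n k ≡ qfact q k * S q 1 n k)
-- The identity holds for k = 0 as well.
proposition3p8 = (λ a n k 1≤a 1≤n _ q → Mah-qfact q a n 1≤a 1≤n k) , case-a≡1
  where
  case-a≡1 : (n k : ℕ) → 1 ≤ n → 1 ≤ k → (q : ℕ) → Mah q 1 n k ≡ qfact q k * S q 1 n k
  case-a≡1 n k 1≤n _ q = begin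
    Mah q 1 n k                     ≡⟨ sym (*-identityʳ _) ⟩
    Mah q 1 n k * 1                 ≡⟨ cong (Mah q 1 n k *_) (sym (trans (cong (_^ n) (qfact-one q)) (^-zeroˡ n))) ⟩
    Mah q 1 n k * qfact q 1 ^ n     ≡⟨ Mah-qfact q 1 n ≤-refl 1≤n k ⟩
    qfact q k * S q 1 n k           ∎
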